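{- Let $(G,k)$ and $(G',k')$ be instances of Max-Cut-AEE such that $(G',k')$ is obtained from $(G,k)$ by one application of one of Rules 1, 2, 3, 4 below. Then $G'$ is connected, and if $(G',k')$ is a yes-instance of Max-Cut-AEE then so is $(G,k)$.
   Context: Max-Cut-AEE: an instance is a connected graph $G$ with $n$ vertices and $m$ edges and an integer $k$; it is a yes-instance iff $G$ has a cut of size at least $\frac{m}{2}+\frac{n-1}{4}+\frac{k}{4}$ (a cut is given by $T\subseteq V(G)$, its size being the number of edges with exactly one endpoint in $T$). $G-X$ denotes the subgraph induced by $V(G)\setminus X$. The rules act on a connected graph $G$ and parameter $k$ (and may mark vertices, which is irrelevant here): Rule 1: if there are $v\in V(G)$ and $X\subseteq V(G)$ such that $X$ is a connected component of $G-\{v\}$ and $X\cup\{v\}$ is a clique, remove all vertices of $X$; decrease $k$ by $1$ if $|X|$ is odd, otherwise keep $k$. Rule 2: applicable only if Rule 1 is not applicable to $G$; if there are $v\in V(G)$ and $X\subseteq V(G)$ such that $X$ is a connected component of $G-\{v\}$ and $X$ is a clique, remove all vertices of $X$, mark $v$, decrease $k$ by $2$. Rule 3: if there are $a,b,c\in V(G)$ with $\{a,b\},\{b,c\}\in E(G)$, $\{a,c\}\notin E(G)$ and $G-\{a,b,c\}$ connected, remove $a,b,c$, mark them, decrease $k$ by $1$. Rule 4: if there are $x,y\in V(G)$ with $\{x,y\}\notin E(G)$ such that $G-\{x,y\}$ has exactly two connected components $X$ and $Y$, and $X\cup\{x\}$ and $X\cup\{y\}$ are cliques, remove $\{x,y\}\cup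 X$, mark $x,y$, decrease $k$ by $1$. -}

module Defs where

open import Data.Bool using (Bool; true; false; _∧_; _xor_; if_then_else_)
open import Data.Nat as ℕ using (ℕ; _<ᵇ_; _%_)
open import Data.Integer as ℤ using (ℤ; +_; _-_; _≤_)
open import Data.Fin using (Fin; toℕ)
open import Data.Fin.Subset using (Subset; _∈_; _∉_; _⊆_; _─_; _∪_; _∩_; ⁅_⁆; ∣_∣; Nonempty; Empty)
open import Data.List using (List; map; allFin)
open import Data.Nat.ListAction using (sum)
open import Data.Vec using (lookup)
open import Data.Product using (Σ; ∃; ∃-syntax; _×_; _,_)
open import Data.Sum using (_⊎_)
open import Relation.Binary.PropositionalEquality using (_≡_; _≢_)
open import Relation.Nullary using (¬_)

-- All graphs in the statement are induced subgraphs of an ambient graph,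
-- given by a vertex set S : Subset N; G - X is then S ─ X.
record Graph (N : ℕ) : Set where
  field
    adj   : Fin N → Fin N → Bool
    sym   : ∀ u v → adj u v ≡ adj v u
    irrefl : ∀ v → adj v v ≡ false
open Graph public

module _ {N : ℕ} (G : Graph N) where

  Adj : Fin N → Fin N → Set
  Adj u v = adj G u v ≡ true

  data Reach (S : Subset N) (u : Fin N) : Fin N → Set where
    here : u ∈ S → Reach S u u
    step : ∀ {w v} → Reach S u w → Adj w v → v ∈ S → Reach S u v

  Connected : Subset N → Set
  Connected S = Nonempty S × (∀ u v → u ∈ S → v ∈ S → Reach S u v)

  Component : Subset N → Subset N → Set
  Component S X = X ⊆ S × Connected X
                × (∀ u w → u ∈ X → w ∈ S → w ∉ X → ¬ Adj u w)

  Clique : Subset N → Set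
  Clique X = ∀ u w → u ∈ X → w ∈ X → u ≢ w → Adj u w

  private
    ΣF : (Fin N → ℕ) → ℕ
    ΣF f = sum (map f (allFin N))

    ind : Bool → ℕ
    ind b = if b then 1 else 0

  -- number of edges of G[S] (unordered pairs counted once via toℕ i < toℕ j)
  edges : Subset N → ℕ
  edges S = ΣF λ i → ΣF λ j →
    ind ((toℕ i <ᵇ toℕ j) ∧ lookup S i ∧ lookup S j ∧ adj G i j)

  cutSize : Subset N → Subset N → ℕ
  cutSize S T = ΣF λ i → ΣF λ j →
    ind ((toℕ i <ᵇ toℕ j) ∧ lookup S i ∧ lookup S j ∧ adj G i j
         ∧ (lookup T i xor lookup T j))

  -- (G[S], k) is a yes-instance of Max-Cut-AEE:
  -- some cut has size ≥ m/2 + (n-1)/4 + k/4, i.e. 4·cut ≥ 2m + n - 1 + k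
  YesInstance : Subset N → ℤ → Set
  YesInstance S k = ∃[ T ] (T ⊆ S ×
    (+ (2 ℕ.* edges S) ℤ.+ + ∣ S ∣ - + 1 ℤ.+ k ≤ + (4 ℕ.* cutSize S T)))

  Rule1Cond : Subset N → Fin N → Subset N → Set
  Rule1Cond S v X = v ∈ S × Component (S ─ ⁅ v ⁆) X × Clique (X ∪ ⁅ v ⁆)

  Rule1Applicable : Subset N → Set
  Rule1Applicable S = ∃[ v ] ∃[ X ] Rule1Cond S v X

  data RuleStep (S : Subset N) (k : ℤ) : Subset N → ℤ → Set where
    rule1 : ∀ v X → Rule1Cond S v X →
            RuleStep S k (S ─ X) (k - + (∣ X ∣ % 2))
    rule2 : ∀ v X → ¬ Rule1Applicable S →
            v ∈ S → Component (S ─ ⁅ v ⁆) X → Clique X →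
            RuleStep S k (S ─ X) (k - + 2)
    rule3 : ∀ a b c → a ∈ S → b ∈ S → c ∈ S → a ≢ c →
            Adj a b → Adj b c → ¬ Adj a c →
            Connected (S ─ (⁅ a ⁆ ∪ ⁅ b ⁆ ∪ ⁅ c ⁆)) →
            RuleStep S k (S ─ (⁅ a ⁆ ∪ ⁅ b ⁆ ∪ ⁅ c ⁆)) (k - + 1)
    rule4 : ∀ x y X Y → x ∈ S → y ∈ S → x ≢ y → ¬ Adj x y →
            Component (S ─ (⁅ x ⁆ ∪ ⁅ y ⁆)) X →
            Component (S ─ (⁅ x ⁆ ∪ ⁅ y ⁆)) Y →
            Empty (X ∩ Y) →
            (X ∪ Y) ≡ (S ─ (⁅ x ⁆ ∪ ⁅ y ⁆)) →
            Clique (X ∪ ⁅ x ⁆) → Clique (X ∪ ⁅ y ⁆) →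
            RuleStep S k (S ─ (⁅ x ⁆ ∪ ⁅ y ⁆ ∪ X)) (k - + 1)

-- Edge and cut counts are values of the bilinear form E p q = ∑ᵢ ∑ⱼ pᵢ qⱼ Aᵢⱼ on 0/1 weight
-- vectors (module EdgeForm), so counting arguments become algebra with E.  The heart of the
-- proof is one extension principle (Extension.extend): if R ⊆ S and every cut T' of G[S ∖ R]
-- can be completed by a colouring of R whose cut edges incident to R pay, four times over,
-- for twice the edges incident to R, for |R| and for Δ, then a certificate for (S ∖ R, k - Δ)
-- yields one for (S, k).  Such colourings come from two sufficient conditions: a Balanced
-- colouring of G[R] (use it or its complement, whichever cuts more edges towards S ∖ R), and
-- a Pendant colouring when every edge between R and S ∖ R meets one vertex v.
-- Each rule then needs one concrete colouring and an arithmetic estimate: Rules 1 and 2 split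
-- a clique X hanging at v into two halves (pendant), Rule 3 colours the middle of a path
-- a – b – c against its ends, and Rule 4 colours x, y against half of the clique X (balanced).
-- Connectivity: Rules 1 and 2 remove a component of G[S] - v, which keeps G[S] connected
-- through v; Rule 3 assumes it; after Rule 4 exactly the component Y remains.
module Submission where

open import Defs hiding (sym)
open import Data.Bool using (Bool; true; false; _∧_; _∨_; not; _xor_; if_then_else_)
open import Data.Bool.Properties
  using (∧-zeroʳ; ∧-identityʳ; ∧-idem; ∧-conicalˡ; ∧-conicalʳ; ∨-conicalˡ; ∨-conicalʳ; ¬-not; not-involutive; xor-comm)
open import Data.Nat using (ℕ; zero; suc; _+_; _*_; _≤_; _<ᵇ_; z≤n; s≤s; _/_; _%_)
open import Data.Nat.Properties
open import Data.Nat.DivMod using (m≡m%n+[m/n]*n; m%n<n)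
open import Data.Nat.ListAction using (sum)
open import Data.Nat.Tactic.RingSolver using (solve-∀)
open import Data.Integer as ℤ using (ℤ)
open import Data.Fin using (Fin; zero; suc; toℕ)
open import Data.Fin.Properties using () renaming (_≟_ to _≟ᶠ_)
open import Data.Fin.Subset using (Subset; _∈_; _∉_; _⊆_; _─_; _∪_; _∩_; ⁅_⁆; ∣_∣; Nonempty; Empty)
open import Data.Fin.Subset.Properties using (x∈p∪q⁻; x∈p∪q⁺; x∈p∩q⁺; x∈⁅x⁆; x∈⁅y⁆⇒x≡y; p─q⊆p)
open import Data.List using (map; allFin)
import Data.List as List
open import Data.List.Properties using (map-tabulate)
open import Data.Vec using (lookup; tabulate; []; _∷_)
import Data.Vec.Functional as Fun
open import Data.Vec.Properties using (lookup-zipWith; lookup-replicate; lookup∘tabulate; []=⇒lookup; lookup⇒[]=)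
open import Data.Product using (Σ; ∃; ∃-syntax; _×_; _,_; proj₁; proj₂)
open import Data.Sum using (_⊎_; inj₁; inj₂; [_,_]′)
open import Data.Empty using (⊥; ⊥-elim)
open import Function using (id; _∘_)
open import Relation.Nullary using (¬_; yes; no)
open import Relation.Binary.PropositionalEquality

cong₃ : ∀ {A B C D : Set} (f : A → B → C → D) {a a' b b' c c'} → a ≡ a' → b ≡ b' → c ≡ c' → f a b c ≡ f a' b' c'
cong₃ f refl refl refl = refl

ind : Bool → ℕ
ind b = if b then 1 else 0

ind-∧ : ∀ a b → ind (a ∧ b) ≡ ind a * ind b
ind-∧ true  b = sym (+-identityʳ (ind b))
ind-∧ false b = refl

ind≤1 : ∀ b → ind b ≤ 1
ind≤1 true  = ≤-refl
ind≤1 false = z≤n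

∑ : ∀ {n} → (Fin n → ℕ) → ℕ
∑ {zero}  f = 0
∑ {suc n} f = f zero + ∑ (λ i → f (suc i))

sum-allFin : ∀ {n} (f : Fin n → ℕ) → sum (map f (allFin n)) ≡ ∑ f
sum-allFin f = trans (cong sum (map-tabulate id f)) (sum-tabulate f)
  where
    sum-tabulate : ∀ {n} (f : Fin n → ℕ) → sum (List.tabulate f) ≡ ∑ f
    sum-tabulate {zero}  f = refl
    sum-tabulate {suc n} f = cong (f zero +_) (sum-tabulate (λ i → f (suc i)))

∑-cong : ∀ {n} {f g : Fin n → ℕ} → (∀ i → f i ≡ g i) → ∑ f ≡ ∑ g
∑-cong {zero}  _ = refl
∑-cong {suc n} h = cong₂ _+_ (h zero) (∑-cong (λ i → h (suc i)))

∑-mono : ∀ {n} {f g : Fin n → ℕ} → (∀ i → f i ≤ g i) → ∑ f ≤ ∑ g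
∑-mono {zero}  _ = z≤n
∑-mono {suc n} h = +-mono-≤ (h zero) (∑-mono (λ i → h (suc i)))

∑-zero : ∀ {n} → ∑ {n} (λ _ → 0) ≡ 0
∑-zero {zero}  = refl
∑-zero {suc n} = ∑-zero {n}

∑-+ : ∀ {n} (f g : Fin n → ℕ) → ∑ (λ i → f i + g i) ≡ ∑ f + ∑ g
∑-+ {zero}  f g = refl
∑-+ {suc n} f g =
  trans (cong (f zero + g zero +_) (∑-+ (λ i → f (suc i)) (λ i → g (suc i))))
        (interchange (f zero) (g zero) _ _)
  where
    interchange : ∀ a b c d → (a + b) + (c + d) ≡ (a + c) + (b + d)
    interchange = solve-∀

∑-*ˡ : ∀ {n} (c : ℕ) (f : Fin n → ℕ) → ∑ (λ i → c * f i) ≡ c * ∑ f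
∑-*ˡ {zero}  c f = sym (*-zeroʳ c)
∑-*ˡ {suc n} c f =
  trans (cong (c * f zero +_) (∑-*ˡ c (λ i → f (suc i)))) (sym (*-distribˡ-+ c (f zero) _))

∑-swap : ∀ {n m} (f : Fin n → Fin m → ℕ) →
         ∑ (λ i → ∑ (λ j → f i j)) ≡ ∑ (λ j → ∑ (λ i → f i j))
∑-swap {zero}  {m} f = sym (∑-zero {m})
∑-swap {suc n}     f =
  trans (cong (∑ (f zero) +_) (∑-swap (λ i j → f (suc i) j)))
        (sym (∑-+ (f zero) (λ j → ∑ (λ i → f (suc i) j))))

∑∑-product : ∀ {n} (f g : Fin n → ℕ) → ∑ (λ i → ∑ (λ j → f i * g j)) ≡ ∑ f * ∑ g
∑∑-product f g = begin
  ∑ (λ i → ∑ (λ j → f i * g j))  ≡⟨ ∑-cong (λ i → ∑-*ˡ (f i) g) ⟩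
  ∑ (λ i → f i * ∑ g)            ≡⟨ ∑-cong (λ i → *-comm (f i) (∑ g)) ⟩
  ∑ (λ i → ∑ g * f i)            ≡⟨ ∑-*ˡ (∑ g) f ⟩
  ∑ g * ∑ f                      ≡⟨ *-comm (∑ g) (∑ f) ⟩
  ∑ f * ∑ g                      ∎
  where open ≡-Reasoning

true≢false : ∀ {a} → a ≡ true → a ≡ false → ⊥
true≢false refl ()

∧-intro : ∀ {a b} → a ≡ true → b ≡ true → a ∧ b ≡ true
∧-intro refl refl = refl

not-true : ∀ {a} → not a ≡ true → a ≡ false
not-true {false} _ = refl

not-false : ∀ {a} → a ≡ false → not a ≡ true
not-false refl = refl

∧-absorbs : ∀ x c → (c ≡ true → x ≡ true) → x ∧ c ≡ c
∧-absorbs true  c     _ = refl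
∧-absorbs false true  h = h refl
∧-absorbs false false _ = refl

∨-introʳ : ∀ {a b} → b ≡ true → a ∨ b ≡ true
∨-introʳ {true}  _ = refl
∨-introʳ {false} h = h

∨-elim : ∀ {a b} → a ∨ b ≡ true → a ≡ true ⊎ b ≡ true
∨-elim {true}  _ = inj₁ refl
∨-elim {false} h = inj₂ h

-- Boolean equality test on Fin; it makes the indicator of ⁅ v ⁆ compute.
_=ᵇ_ : ∀ {n} → Fin n → Fin n → Bool
zero  =ᵇ zero  = true
zero  =ᵇ suc j = false
suc i =ᵇ zero  = false
suc i =ᵇ suc j = i =ᵇ j

=ᵇ-refl : ∀ {n} (i : Fin n) → (i =ᵇ i) ≡ true
=ᵇ-refl zero    = refl
=ᵇ-refl (suc i) = =ᵇ-refl i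

=ᵇ⇒≡ : ∀ {n} {i j : Fin n} → (i =ᵇ j) ≡ true → i ≡ j
=ᵇ⇒≡ {i = zero}  {zero}  _ = refl
=ᵇ⇒≡ {i = suc i} {suc j} e = cong suc (=ᵇ⇒≡ e)

≢⇒=ᵇ-false : ∀ {n} {i j : Fin n} → i ≢ j → (i =ᵇ j) ≡ false
≢⇒=ᵇ-false {i = i} {j} i≢j with i =ᵇ j in e
... | true  = ⊥-elim (i≢j (=ᵇ⇒≡ e))
... | false = refl

=ᵇ-false⇒≢ : ∀ {n} {i j : Fin n} → (i =ᵇ j) ≡ false → i ≢ j
=ᵇ-false⇒≢ {i = i} e refl = true≢false (=ᵇ-refl i) e

=ᵇ-sym : ∀ {n} (i j : Fin n) → (i =ᵇ j) ≡ (j =ᵇ i)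
=ᵇ-sym zero    zero    = refl
=ᵇ-sym zero    (suc j) = refl
=ᵇ-sym (suc i) zero    = refl
=ᵇ-sym (suc i) (suc j) = =ᵇ-sym i j

=ᵇ-disjoint : ∀ {n} (i : Fin n) {u w : Fin n} → u ≢ w → (i =ᵇ u) ∧ (i =ᵇ w) ≡ false
=ᵇ-disjoint i {u} {w} u≢w with i =ᵇ u in iu
... | false = refl
... | true  = ≢⇒=ᵇ-false (λ i≡w → u≢w (trans (sym (=ᵇ⇒≡ {i = i} iu)) i≡w))

δ : ∀ {n} → Fin n → Fin n → ℕ
δ v i = ind (i =ᵇ v)

∑-δ : ∀ {n} (v : Fin n) (f : Fin n → ℕ) → ∑ (λ i → δ v i * f i) ≡ f v
∑-δ {suc n} zero    f = trans (cong (f zero + 0 +_) (∑-zero {n})) (trans (+-identityʳ _) (+-identityʳ _))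
∑-δ {suc n} (suc v) f = ∑-δ v (λ i → f (suc i))

∑-δ≡1 : ∀ {n} (v : Fin n) → ∑ (δ v) ≡ 1
∑-δ≡1 v = trans (∑-cong (λ i → sym (*-identityʳ (δ v i)))) (∑-δ v (λ _ → 1))

δ≤ : ∀ {n} (v : Fin n) (f : Fin n → ℕ) → 1 ≤ f v → ∀ i → δ v i ≤ f i
δ≤ v f 1≤fv i with i =ᵇ v in e
... | true  = subst (λ x → 1 ≤ f x) (sym (=ᵇ⇒≡ e)) 1≤fv
... | false = z≤n

∑∑-symmetric : ∀ {n} (F : Fin n → Fin n → ℕ) → (∀ i j → F i j ≡ F j i) → (∀ i → F i i ≡ 0) →
               2 * ∑ (λ i → ∑ (λ j → ind (toℕ i <ᵇ toℕ j) * F i j)) ≡ ∑ (λ i → ∑ (F i))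
∑∑-symmetric {n} F F-sym F-diag = sym (begin
  ∑ (λ i → ∑ (F i))
    ≡⟨ ∑-cong (λ i → ∑-cong (λ j → split i j)) ⟩
  ∑ (λ i → ∑ (λ j → lt i j * F i j + lt j i * F i j + δ j i * F i j))
    ≡⟨ ∑-cong (λ i → trans (∑-+ (λ j → lt i j * F i j + lt j i * F i j) (λ j → δ j i * F i j))
                           (cong (_+ C i) (∑-+ (λ j → lt i j * F i j) (λ j → lt j i * F i j)))) ⟩
  ∑ (λ i → A i + B i + C i)
    ≡⟨ trans (∑-+ (λ i → A i + B i) C) (cong (_+ ∑ C) (∑-+ A B)) ⟩
  ∑ A + ∑ B + ∑ C
    ≡⟨ cong₂ (λ b c → ∑ A + b + c) transposed diagonal ⟩
  ∑ A + ∑ A + 0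
    ≡⟨ double (∑ A) ⟩
  2 * ∑ A ∎)
  where
    open ≡-Reasoning
    lt : Fin n → Fin n → ℕ
    lt i j = ind (toℕ i <ᵇ toℕ j)
    A B C : Fin n → ℕ
    A i = ∑ (λ j → lt i j * F i j)
    B i = ∑ (λ j → lt j i * F i j)
    C i = ∑ (λ j → δ j i * F i j)
    trichotomy : ∀ {n} (i j : Fin n) → ind (toℕ i <ᵇ toℕ j) + ind (toℕ j <ᵇ toℕ i) + ind (i =ᵇ j) ≡ 1
    trichotomy zero    zero    = refl
    trichotomy zero    (suc j) = refl
    trichotomy (suc i) zero    = refl
    trichotomy (suc i) (suc j) = trichotomy i j
    split : ∀ i j → F i j ≡ lt i j * F i j + lt j i * F i j + δ j i * F i j
    split i j = begin
      F i j                                          ≡⟨ sym (*-identityˡ (F i j)) ⟩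
      1 * F i j                                      ≡⟨ cong (_* F i j) (sym (trichotomy i j)) ⟩
      (lt i j + lt j i + ind (i =ᵇ j)) * F i j       ≡⟨ distrib (lt i j) (lt j i) (ind (i =ᵇ j)) (F i j) ⟩
      lt i j * F i j + lt j i * F i j + δ j i * F i j ∎
      where
        distrib : ∀ a b c x → (a + b + c) * x ≡ a * x + b * x + c * x
        distrib = solve-∀
    transposed : ∑ B ≡ ∑ A
    transposed = trans (∑-swap (λ i j → lt j i * F i j))
                       (∑-cong (λ a → ∑-cong (λ b → cong (lt a b *_) (F-sym b a))))
    diagonal : ∑ C ≡ 0
    diagonal = trans (∑-cong (λ i → trans (∑-cong (λ j → cong (λ x → ind x * F i j) (=ᵇ-sym i j)))
                                          (trans (∑-δ i (F i)) (F-diag i))))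
                     (∑-zero {n})
    double : ∀ x → x + x + 0 ≡ 2 * x
    double = solve-∀

# : ∀ {n} → (Fin n → Bool) → ℕ
# p = ∑ (λ i → ind (p i))

#-≥1 : ∀ {n} (p : Fin n → Bool) a → p a ≡ true → 1 ≤ # p
#-≥1 p a pa = subst (_≤ # p) (∑-δ≡1 a) (∑-mono (δ≤ a (λ i → ind (p i)) (≤-reflexive (sym (cong ind pa)))))

#-≥2 : ∀ {n} (p : Fin n → Bool) a a' → a ≢ a' → p a ≡ true → p a' ≡ true → 2 ≤ # p
#-≥2 p a a' a≢a' pa pa' =
  subst (_≤ # p) (trans (∑-+ (δ a) (δ a')) (cong₂ _+_ (∑-δ≡1 a) (∑-δ≡1 a'))) (∑-mono below)
  where
    below : ∀ i → δ a i + δ a' i ≤ ind (p i)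
    below i with i =ᵇ a in e | i =ᵇ a' in e'
    ... | true  | true  = ⊥-elim (a≢a' (trans (sym (=ᵇ⇒≡ {i = i} e)) (=ᵇ⇒≡ {i = i} e')))
    ... | true  | false = subst (λ x → 1 ≤ ind (p x)) (sym (=ᵇ⇒≡ e)) (≤-reflexive (sym (cong ind pa)))
    ... | false | true  = subst (λ x → 1 ≤ ind (p x)) (sym (=ᵇ⇒≡ e')) (≤-reflexive (sym (cong ind pa')))
    ... | false | false = z≤n

find : ∀ {n} (p : Fin n → Bool) → (∃ λ i → p i ≡ true) ⊎ (∀ i → p i ≡ false)
find {zero}  p = inj₂ (λ ())
find {suc n} p with p zero in e
... | true  = inj₁ (zero , e)
... | false with find (λ i → p (suc i))
...   | inj₁ (i , h) = inj₁ (suc i , h)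
...   | inj₂ h       = inj₂ (λ { zero → e ; (suc i) → h i })

choose : ∀ {n} (p : Fin n → Bool) (m : ℕ) → m ≤ # p →
         Σ (Fin n → Bool) λ q → (∀ i → q i ≡ true → p i ≡ true) × # q ≡ m
choose {zero}  p .zero z≤n = (λ ()) , (λ ()) , refl
choose {suc n} p m m≤ with p zero in e
choose {suc n} p zero    _         | true = (λ _ → false) , (λ _ ()) , ∑-zero {suc n}
choose {suc n} p (suc m) (s≤s m≤)  | true with choose (λ i → p (suc i)) m m≤
... | q , q⊆p , #q = true Fun.∷ q , (λ { zero _ → e ; (suc i) h → q⊆p i h }) , cong suc #q
choose {suc n} p m       m≤        | false with choose (λ i → p (suc i)) m m≤
... | q , q⊆p , #q = false Fun.∷ q , (λ { zero () ; (suc i) h → q⊆p i h }) , #q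

∈⇒true : ∀ {n} {i : Fin n} {p : Subset n} → i ∈ p → lookup p i ≡ true
∈⇒true = []=⇒lookup

true⇒∈ : ∀ {n} {i : Fin n} {p : Subset n} → lookup p i ≡ true → i ∈ p
true⇒∈ {i = i} {p} = lookup⇒[]= i p

lookup-─ : ∀ {n} (p q : Subset n) i → lookup (p ─ q) i ≡ lookup p i ∧ not (lookup q i)
lookup-─ (x ∷ p) (true  ∷ q) zero    = sym (∧-zeroʳ x)
lookup-─ (x ∷ p) (false ∷ q) zero    = sym (∧-identityʳ x)
lookup-─ (x ∷ p) (y ∷ q)     (suc i) = lookup-─ p q i

lookup-∪ : ∀ {n} (p q : Subset n) i → lookup (p ∪ q) i ≡ lookup p i ∨ lookup q i
lookup-∪ p q i = lookup-zipWith _∨_ i p q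

lookup-⁅⁆ : ∀ {n} (v i : Fin n) → lookup ⁅ v ⁆ i ≡ (i =ᵇ v)
lookup-⁅⁆ zero    zero    = refl
lookup-⁅⁆ zero    (suc i) = lookup-replicate i false
lookup-⁅⁆ (suc v) zero    = refl
lookup-⁅⁆ (suc v) (suc i) = lookup-⁅⁆ v i

∣∣≡# : ∀ {n} (p : Subset n) → ∣ p ∣ ≡ # (lookup p)
∣∣≡# []          = refl
∣∣≡# (true ∷ p)  = cong suc (∣∣≡# p)
∣∣≡# (false ∷ p) = ∣∣≡# p

∈─⁻ : ∀ {n} {A B : Subset n} {i} → i ∈ A ─ B → lookup A i ≡ true × lookup B i ≡ false
∈─⁻ {A = A} {B} {i} i∈ =
  let h = trans (sym (lookup-─ A B i)) (∈⇒true i∈) in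
  ∧-conicalˡ _ _ h , not-true (∧-conicalʳ (lookup A i) _ h)

∈─⁺ : ∀ {n} {A B : Subset n} {i} → lookup A i ≡ true → lookup B i ≡ false → i ∈ A ─ B
∈─⁺ {A = A} {B} {i} a b = true⇒∈ (trans (lookup-─ A B i) (∧-intro a (not-false b)))

∉⁅⁆ : ∀ {n} {v i : Fin n} → i ≢ v → lookup ⁅ v ⁆ i ≡ false
∉⁅⁆ {v = v} {i} i≢v = trans (lookup-⁅⁆ v i) (≢⇒=ᵇ-false i≢v)

⁅⁆-false⇒≢ : ∀ {n} {v i : Fin n} → lookup ⁅ v ⁆ i ≡ false → i ≢ v
⁅⁆-false⇒≢ {v = v} {i} i∉v = =ᵇ-false⇒≢ (trans (sym (lookup-⁅⁆ v i)) i∉v)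

∈⁅⁆ : ∀ {n} (v : Fin n) → lookup ⁅ v ⁆ v ≡ true
∈⁅⁆ v = trans (lookup-⁅⁆ v v) (=ᵇ-refl v)

lookup-pair∪ : ∀ {n} (u w : Fin n) (Z : Subset n) i →
               lookup (⁅ u ⁆ ∪ ⁅ w ⁆ ∪ Z) i ≡ (i =ᵇ u) ∨ ((i =ᵇ w) ∨ lookup Z i)
lookup-pair∪ u w Z i =
  trans (lookup-∪ ⁅ u ⁆ (⁅ w ⁆ ∪ Z) i)
        (cong₂ _∨_ (lookup-⁅⁆ u i) (trans (lookup-∪ ⁅ w ⁆ Z i) (cong (_∨ lookup Z i) (lookup-⁅⁆ w i))))

pair∪-⊆ : ∀ {n} {S Z : Subset n} {u w} → u ∈ S → w ∈ S → (∀ i → lookup Z i ≡ true → lookup S i ≡ true) →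
          ∀ i → lookup (⁅ u ⁆ ∪ ⁅ w ⁆ ∪ Z) i ≡ true → lookup S i ≡ true
pair∪-⊆ {S = S} {Z} {u} {w} u∈S w∈S Z⊆S i i∈ with ∨-elim (trans (sym (lookup-pair∪ u w Z i)) i∈)
... | inj₁ i=u = subst (λ x → lookup S x ≡ true) (sym (=ᵇ⇒≡ i=u)) (∈⇒true u∈S)
... | inj₂ i∈wZ with ∨-elim i∈wZ
...   | inj₁ i=w = subst (λ x → lookup S x ≡ true) (sym (=ᵇ⇒≡ i=w)) (∈⇒true w∈S)
...   | inj₂ i∈Z = Z⊆S i i∈Z

-- Boolean identities for the indicator of a cut edge {i, j}: a = i ∈ S, b = j ∈ S,
-- c = edge, d = i ∈ T, e = j ∈ T.
private
  cut-crossing : ∀ a b c d e → ind (a ∧ b ∧ c ∧ (d xor e)) ≡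
                 ind (a ∧ d) * ind (b ∧ not e) * ind c + ind (a ∧ not d) * ind (b ∧ e) * ind c
  cut-crossing false _     _     _     _     = refl
  cut-crossing true  false _     true  _     = refl
  cut-crossing true  false _     false _     = refl
  cut-crossing true  true  true  true  true  = refl
  cut-crossing true  true  true  true  false = refl
  cut-crossing true  true  true  false true  = refl
  cut-crossing true  true  true  false false = refl
  cut-crossing true  true  false true  true  = refl
  cut-crossing true  true  false true  false = refl
  cut-crossing true  true  false false true  = refl
  cut-crossing true  true  false false false = refl

  cut-swap : ∀ a b c d e → ind (a ∧ b ∧ c ∧ (d xor e)) ≡ ind (b ∧ a ∧ c ∧ (e xor d))
  cut-swap true  true  c d e = cong (λ x → ind (c ∧ x)) (xor-comm d e)
  cut-swap true  false _ _ _ = refl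
  cut-swap false true  _ _ _ = refl
  cut-swap false false _ _ _ = refl

  cut-loop : ∀ a x → ind (a ∧ a ∧ false ∧ x) ≡ 0
  cut-loop true  _ = refl
  cut-loop false _ = refl

-- Edges and cuts of induced subgraphs are values of E on indicator vectors.
module EdgeForm {N : ℕ} (G : Graph N) where

  A : Fin N → Fin N → ℕ
  A i j = ind (adj G i j)

  A-sym : ∀ i j → A i j ≡ A j i
  A-sym i j = cong ind (Graph.sym G i j)

  A-diag : ∀ i → A i i ≡ 0
  A-diag i = cong ind (irrefl G i)

  E : (Fin N → ℕ) → (Fin N → ℕ) → ℕ
  E p q = ∑ λ i → ∑ λ j → p i * q j * A i j

  χ : Subset N → Fin N → ℕ
  χ S i = ind (lookup S i)

  E-cong : ∀ {p p' q q'} → (∀ i → p i ≡ p' i) → (∀ j → q j ≡ q' j) → E p q ≡ E p' q'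
  E-cong hp hq = ∑-cong (λ i → ∑-cong (λ j → cong₂ (λ a b → a * b * A i j) (hp i) (hq j)))

  E-congʳ : ∀ p {q q'} → (∀ j → q j ≡ q' j) → E p q ≡ E p q'
  E-congʳ p = E-cong {p = p} (λ _ → refl)

  E-mono : ∀ {p p' q q'} → (∀ i → p i ≤ p' i) → (∀ j → q j ≤ q' j) → E p q ≤ E p' q'
  E-mono hp hq = ∑-mono (λ i → ∑-mono (λ j → *-monoˡ-≤ (A i j) (*-mono-≤ (hp i) (hq j))))

  E-sym : ∀ p q → E p q ≡ E q p
  E-sym p q = trans (∑-swap (λ i j → p i * q j * A i j))
                    (∑-cong (λ a → ∑-cong (λ b → trans (swap (p b) (q a) (A b a))
                                                         (cong (q a * p b *_) (A-sym b a)))))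
    where
      swap : ∀ a b c → a * b * c ≡ b * a * c
      swap = solve-∀

  E-+ˡ : ∀ p p' q → E (λ i → p i + p' i) q ≡ E p q + E p' q
  E-+ˡ p p' q =
    trans (∑-cong (λ i → trans (∑-cong (λ j → distrib (p i) (p' i) (q j) (A i j)))
                               (∑-+ (λ j → p i * q j * A i j) (λ j → p' i * q j * A i j))))
          (∑-+ (λ i → ∑ (λ j → p i * q j * A i j)) (λ i → ∑ (λ j → p' i * q j * A i j)))
    where
      distrib : ∀ a b c d → (a + b) * c * d ≡ a * c * d + b * c * d
      distrib = solve-∀

  E-+ʳ : ∀ p q q' → E p (λ j → q j + q' j) ≡ E p q + E p q'
  E-+ʳ p q q' = begin
    E p (λ j → q j + q' j)  ≡⟨ E-sym p _ ⟩
    E (λ j → q j + q' j) p  ≡⟨ E-+ˡ q q' p ⟩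
    E q p + E q' p          ≡⟨ cong₂ _+_ (E-sym q p) (E-sym q' p) ⟩
    E p q + E p q'          ∎
    where open ≡-Reasoning

  E-square : ∀ p q → E (λ i → p i + q i) (λ i → p i + q i) ≡ E p p + 2 * E p q + E q q
  E-square p q = begin
    E (λ i → p i + q i) (λ i → p i + q i)          ≡⟨ E-+ˡ p q _ ⟩
    E p (λ i → p i + q i) + E q (λ i → p i + q i)  ≡⟨ cong₂ _+_ (E-+ʳ p p q) (E-+ʳ q p q) ⟩
    (E p p + E p q) + (E q p + E q q)              ≡⟨ cong (λ x → (E p p + E p q) + (x + E q q)) (E-sym q p) ⟩
    (E p p + E p q) + (E p q + E q q)              ≡⟨ regroup (E p p) (E p q) (E q q) ⟩
    E p p + 2 * E p q + E q q                      ∎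
    where
      open ≡-Reasoning
      regroup : ∀ a b c → (a + b) + (b + c) ≡ a + 2 * b + c
      regroup = solve-∀

  E-δ : ∀ v q → E (δ v) q ≡ ∑ (λ j → q j * A v j)
  E-δ v q = trans (∑-cong (λ i → trans (∑-cong (λ j → *-assoc (δ v i) (q j) (A i j)))
                                       (∑-*ˡ (δ v i) (λ j → q j * A i j))))
                  (∑-δ v (λ i → ∑ (λ j → q j * A i j)))

  E-δδ : ∀ u w → E (δ u) (δ w) ≡ A u w
  E-δδ u w = trans (E-δ u (δ w)) (∑-δ w (A u))

  E-independent-pair : ∀ u w → adj G u w ≡ false → E (λ i → δ u i + δ w i) (λ i → δ u i + δ w i) ≡ 0
  E-independent-pair u w uw = begin
    E (λ i → δ u i + δ w i) (λ i → δ u i + δ w i)        ≡⟨ E-square (δ u) (δ w) ⟩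
    E (δ u) (δ u) + 2 * E (δ u) (δ w) + E (δ w) (δ w)  ≡⟨ cong₃ (λ x y z → x + 2 * y + z)
                                                              (trans (E-δδ u u) (A-diag u))
                                                              (trans (E-δδ u w) (cong ind uw))
                                                              (trans (E-δδ w w) (A-diag w)) ⟩
    0                                                  ∎
    where open ≡-Reasoning

  E-δ-# : ∀ v (p : Fin N → Bool) → E (δ v) (λ j → ind (p j)) ≡ # (λ j → p j ∧ adj G v j)
  E-δ-# v p = trans (E-δ v _) (∑-cong (λ j → sym (ind-∧ (p j) (adj G v j))))

  E-δ-complete : ∀ v (p : Fin N → Bool) → (∀ j → p j ≡ true → adj G v j ≡ true) →
                 E (δ v) (λ j → ind (p j)) ≡ # p
  E-δ-complete v p p⊆N = trans (E-δ-# v p) (∑-cong (λ j → cong ind (restrict j)))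
    where
      restrict : ∀ j → p j ∧ adj G v j ≡ p j
      restrict j with p j in e
      ... | true  = p⊆N j e
      ... | false = refl

  private
    ∑∑-allFin : (f : Fin N → Fin N → ℕ) →
                sum (map (λ i → sum (map (f i) (allFin N))) (allFin N)) ≡ ∑ (λ i → ∑ (f i))
    ∑∑-allFin f = trans (sum-allFin (λ i → sum (map (f i) (allFin N)))) (∑-cong (λ i → sum-allFin (f i)))

  edges-as-E : ∀ S → 2 * edges G S ≡ E (χ S) (χ S)
  edges-as-E S = begin
    2 * edges G S
      ≡⟨ cong (2 *_) (∑∑-allFin (λ i j → ind ((toℕ i <ᵇ toℕ j) ∧ lookup S i ∧ lookup S j ∧ adj G i j))) ⟩
    2 * ∑ (λ i → ∑ (λ j → ind ((toℕ i <ᵇ toℕ j) ∧ lookup S i ∧ lookup S j ∧ adj G i j)))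
      ≡⟨ cong (2 *_) (∑-cong (λ i → ∑-cong (λ j → factor i j))) ⟩
    2 * ∑ (λ i → ∑ (λ j → ind (toℕ i <ᵇ toℕ j) * F i j))
      ≡⟨ ∑∑-symmetric F F-sym F-diag ⟩
    E (χ S) (χ S) ∎
    where
      open ≡-Reasoning
      F : Fin N → Fin N → ℕ
      F i j = χ S i * χ S j * A i j
      F-sym : ∀ i j → F i j ≡ F j i
      F-sym i j = trans (cong (_* A i j) (*-comm (χ S i) (χ S j))) (cong (χ S j * χ S i *_) (A-sym i j))
      F-diag : ∀ i → F i i ≡ 0
      F-diag i = trans (cong (χ S i * χ S i *_) (A-diag i)) (*-zeroʳ (χ S i * χ S i))
      factor : ∀ i j → ind ((toℕ i <ᵇ toℕ j) ∧ lookup S i ∧ lookup S j ∧ adj G i j) ≡ ind (toℕ i <ᵇ toℕ j) * F i j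
      factor i j = trans (ind-∧ (toℕ i <ᵇ toℕ j) _)
                   (cong (ind (toℕ i <ᵇ toℕ j) *_) (trans (ind-∧ (lookup S i) _)
                      (trans (cong (χ S i *_) (ind-∧ (lookup S j) _)) (sym (*-assoc (χ S i) _ _)))))

  cut-as-E : ∀ S T → cutSize G S T ≡
             E (λ i → ind (lookup S i ∧ lookup T i)) (λ i → ind (lookup S i ∧ not (lookup T i)))
  cut-as-E S T = *-cancelˡ-≡ _ _ 2 (begin
    2 * cutSize G S T
      ≡⟨ cong (2 *_) (∑∑-allFin (λ i j → ind ((toℕ i <ᵇ toℕ j) ∧ F′ i j))) ⟩
    2 * ∑ (λ i → ∑ (λ j → ind ((toℕ i <ᵇ toℕ j) ∧ F′ i j)))
      ≡⟨ cong (2 *_) (∑-cong (λ i → ∑-cong (λ j → ind-∧ (toℕ i <ᵇ toℕ j) (F′ i j)))) ⟩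
    2 * ∑ (λ i → ∑ (λ j → ind (toℕ i <ᵇ toℕ j) * F i j))
      ≡⟨ ∑∑-symmetric F F-sym F-diag ⟩
    ∑ (λ i → ∑ (F i))
      ≡⟨ ∑-cong (λ i → ∑-cong (λ j → cut-crossing (s i) (s j) (adj G i j) (t i) (t j))) ⟩
    ∑ (λ i → ∑ (λ j → P i * Q j * A i j + Q i * P j * A i j))
      ≡⟨ trans (∑-cong (λ i → ∑-+ (λ j → P i * Q j * A i j) (λ j → Q i * P j * A i j)))
               (∑-+ (λ i → ∑ (λ j → P i * Q j * A i j)) (λ i → ∑ (λ j → Q i * P j * A i j))) ⟩
    E P Q + E Q P
      ≡⟨ cong (E P Q +_) (E-sym Q P) ⟩
    E P Q + E P Q
      ≡⟨ cong (E P Q +_) (sym (+-identityʳ _)) ⟩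
    2 * E P Q ∎)
    where
      open ≡-Reasoning
      s t : Fin N → Bool
      s i = lookup S i
      t i = lookup T i
      P Q : Fin N → ℕ
      P i = ind (s i ∧ t i)
      Q i = ind (s i ∧ not (t i))
      F′ : Fin N → Fin N → Bool
      F′ i j = s i ∧ s j ∧ adj G i j ∧ (t i xor t j)
      F : Fin N → Fin N → ℕ
      F i j = ind (F′ i j)
      F-sym : ∀ i j → F i j ≡ F j i
      F-sym i j = trans (cut-swap (s i) (s j) (adj G i j) (t i) (t j))
                        (cong (λ a → ind (s j ∧ s i ∧ a ∧ (t j xor t i))) (Graph.sym G i j))
      F-diag : ∀ i → F i i ≡ 0
      F-diag i = trans (cong (λ a → ind (s i ∧ s i ∧ a ∧ (t i xor t i))) (irrefl G i)) (cut-loop (s i) (t i xor t i))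

  clique-A : ∀ {X} → Clique G X → ∀ i j → i ∈ X → j ∈ X → A i j + ind (i =ᵇ j) ≡ 1
  clique-A cl i j i∈X j∈X with i =ᵇ j in e
  ... | true  = subst (λ x → A x j + 1 ≡ 1) (sym (=ᵇ⇒≡ {i = i} e)) (cong (_+ 1) (A-diag j))
  ... | false = cong (λ a → ind a + 0) (cl i j i∈X j∈X (=ᵇ-false⇒≢ e))

  E-clique : ∀ X → Clique G X → (p p' : Fin N → Bool) →
             (∀ i → p i ≡ true → lookup X i ≡ true) → (∀ i → p' i ≡ true → lookup X i ≡ true) →
             E (λ i → ind (p i)) (λ i → ind (p' i)) + # (λ i → p i ∧ p' i) ≡ # p * # p'
  E-clique X cl p p' p⊆X p'⊆X = begin
    E P P' + # (λ i → p i ∧ p' i)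
      ≡⟨ cong (E P P' +_) (sym diagonal) ⟩
    E P P' + ∑ D
      ≡⟨ sym (∑-+ (λ i → ∑ (λ j → P i * P' j * A i j)) D) ⟩
    ∑ (λ i → ∑ (λ j → P i * P' j * A i j) + D i)
      ≡⟨ ∑-cong (λ i → sym (∑-+ (λ j → P i * P' j * A i j) (λ j → P i * P' j * ind (i =ᵇ j)))) ⟩
    ∑ (λ i → ∑ (λ j → P i * P' j * A i j + P i * P' j * ind (i =ᵇ j)))
      ≡⟨ ∑-cong (λ i → ∑-cong (λ j → pair i j)) ⟩
    ∑ (λ i → ∑ (λ j → P i * P' j))
      ≡⟨ ∑∑-product P P' ⟩
    # p * # p' ∎
    where
      open ≡-Reasoning
      P P' D : Fin N → ℕ
      P i = ind (p i)
      P' i = ind (p' i)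
      D i = ∑ (λ j → P i * P' j * ind (i =ᵇ j))
      diagonal : ∑ D ≡ # (λ i → p i ∧ p' i)
      diagonal = ∑-cong (λ i →
        trans (∑-cong (λ j → trans (*-comm (P i * P' j) _) (cong (λ z → ind z * (P i * P' j)) (=ᵇ-sym i j))))
              (trans (∑-δ i (λ j → P i * P' j)) (sym (ind-∧ (p i) (p' i)))))
      pair : ∀ i j → P i * P' j * A i j + P i * P' j * ind (i =ᵇ j) ≡ P i * P' j
      pair i j with p i in e | p' j in e'
      ... | false | _     = refl
      ... | true  | false = refl
      ... | true  | true  = trans (cong₂ _+_ (*-identityˡ (A i j)) (*-identityˡ (ind (i =ᵇ j))))
                                  (clique-A cl i j (true⇒∈ (p⊆X i e)) (true⇒∈ (p'⊆X j e')))

module IntegerBound where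
  open import Data.Integer as ℤ using (ℤ; +_; -_; _-_) renaming (_+_ to _+ℤ_; _≤_ to _≤ℤ_)
  import Data.Integer.Properties as ℤₚ
  import Data.Integer.Tactic.RingSolver as ℤ-Solver

  -- The bound of YesInstance transfers from the smaller instance to the larger one whenever
  -- the larger one gains Δ more in 4·cut than in 2m + n (all quantities natural numbers).
  bound-transfer : ∀ (m n c m' n' c' Δ : ℕ) (k : ℤ) → m + n + Δ + c' ≤ c + m' + n' →
                   + m' +ℤ + n' - + 1 +ℤ (k - + Δ) ≤ℤ + c' → + m +ℤ + n - + 1 +ℤ k ≤ℤ + c
  bound-transfer m n c m' n' c' Δ k gain old = begin
    + m +ℤ + n - + 1 +ℤ k
      ≡⟨ regroup (+ m) (+ n) (+ c') (+ m') (+ n') (+ Δ) k ⟩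
    (+ m +ℤ + n +ℤ + Δ +ℤ + c') - (+ m' +ℤ + n') +ℤ (+ m' +ℤ + n' - + 1 +ℤ (k - + Δ) - + c')
      ≤⟨ ℤₚ.+-mono-≤ (ℤₚ.+-monoˡ-≤ (- (+ m' +ℤ + n')) gainℤ) (ℤₚ.i≤j⇒i-j≤0 old) ⟩
    (+ c +ℤ + m' +ℤ + n') - (+ m' +ℤ + n') +ℤ + 0
      ≡⟨ cancel (+ c) (+ m') (+ n') ⟩
    + c ∎
    where
      open ℤₚ.≤-Reasoning
      gainℤ : + m +ℤ + n +ℤ + Δ +ℤ + c' ≤ℤ + c +ℤ + m' +ℤ + n'
      gainℤ = subst₂ _≤ℤ_
        (trans (ℤₚ.pos-+ (m + n + Δ) c') (cong (_+ℤ + c') (trans (ℤₚ.pos-+ (m + n) Δ) (cong (_+ℤ + Δ) (ℤₚ.pos-+ m n)))))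
        (trans (ℤₚ.pos-+ (c + m') n') (cong (_+ℤ + n') (ℤₚ.pos-+ c m')))
        (ℤ.+≤+ gain)
      regroup : ∀ a b c d e f k →
                a +ℤ b - + 1 +ℤ k ≡ (a +ℤ b +ℤ f +ℤ c) - (d +ℤ e) +ℤ (d +ℤ e - + 1 +ℤ (k - f) - c)
      regroup = ℤ-Solver.solve-∀
      cancel : ∀ c d e → (c +ℤ d +ℤ e) - (d +ℤ e) +ℤ + 0 ≡ c
      cancel = ℤ-Solver.solve-∀

open IntegerBound using (bound-transfer)

module Extension {N : ℕ} (G : Graph N) where
  open EdgeForm G

  part : Subset N → (Fin N → Bool) → Fin N → ℕ
  part R b i = ind (lookup R i ∧ b i)

  χ-parts : ∀ R b i → χ R i ≡ part R b i + part R (not ∘ b) i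
  χ-parts R b i = split (lookup R i) (b i)
    where
      split : ∀ r c → ind r ≡ ind (r ∧ c) + ind (r ∧ not c)
      split false _     = refl
      split true  true  = refl
      split true  false = refl

  part-not-not : ∀ R b i → part R (not ∘ (not ∘ b)) i ≡ part R b i
  part-not-not R b i = cong (λ x → ind (lookup R i ∧ x)) (not-involutive (b i))

  module Colouring (S' R T' : Subset N) (b : Fin N → Bool) where
    P₁ P₂ Q₁ Q₂ : Fin N → ℕ
    P₁ = part S' (lookup T')
    P₂ = part S' (not ∘ lookup T')
    Q₁ = part R b
    Q₂ = part R (not ∘ b)

    -- S'–R edges cut, resp. not cut
    cross uncut : ℕ
    cross = E P₁ Q₂ + E Q₁ P₂
    uncut = E P₁ Q₁ + E Q₂ P₂

    -- cut edges incident to R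
    newCut : ℕ
    newCut = cross + E Q₁ Q₂

    E-R : E (χ R) (χ R) ≡ E Q₁ Q₁ + 2 * E Q₁ Q₂ + E Q₂ Q₂
    E-R = trans (E-cong (χ-parts R b) (χ-parts R b)) (E-square Q₁ Q₂)

    E-S'R : E (χ S') (χ R) ≡ cross + uncut
    E-S'R = begin
      E (χ S') (χ R)
        ≡⟨ E-cong (χ-parts S' (lookup T')) (χ-parts R b) ⟩
      E (λ i → P₁ i + P₂ i) (λ i → Q₁ i + Q₂ i)
        ≡⟨ trans (E-+ˡ P₁ P₂ _) (cong₂ _+_ (E-+ʳ P₁ Q₁ Q₂) (E-+ʳ P₂ Q₁ Q₂)) ⟩
      (E P₁ Q₁ + E P₁ Q₂) + (E P₂ Q₁ + E P₂ Q₂)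
        ≡⟨ cong₂ (λ x y → (E P₁ Q₁ + E P₁ Q₂) + (x + y)) (E-sym P₂ Q₁) (E-sym P₂ Q₂) ⟩
      (E P₁ Q₁ + E P₁ Q₂) + (E Q₁ P₂ + E Q₂ P₂)
        ≡⟨ regroup (E P₁ Q₁) (E P₁ Q₂) (E Q₁ P₂) (E Q₂ P₂) ⟩
      cross + uncut ∎
      where
        open ≡-Reasoning
        regroup : ∀ a b c d → (a + b) + (c + d) ≡ (b + c) + (a + d)
        regroup = solve-∀

  Gain : (S' R T' : Subset N) → (Fin N → Bool) → ℕ → Set
  Gain S' R T' b Δ = E (χ R) (χ R) + 2 * E (χ S') (χ R) + # (lookup R) + Δ ≤ 4 * newCut
    where open Colouring S' R T' b

  gain-criterion : ∀ S' R T' b Δ → let open Colouring S' R T' b in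
                   E Q₁ Q₁ + E Q₂ Q₂ + # (lookup R) + Δ + 2 * uncut ≤ 2 * E Q₁ Q₂ + 2 * cross →
                   Gain S' R T' b Δ
  gain-criterion S' R T' b Δ H =
    subst₂ _≤_ (sym (cong₂ (λ x y → x + 2 * y + # (lookup R) + Δ) E-R E-S'R)) (double (E Q₁ Q₂) cross)
      (≤-trans (≤-reflexive (regroup (E Q₁ Q₁) (E Q₁ Q₂) (E Q₂ Q₂) (# (lookup R)) Δ cross uncut))
               (+-monoˡ-≤ (2 * E Q₁ Q₂ + 2 * cross) H))
    where
      open Colouring S' R T' b
      regroup : ∀ a e c r d x u →
                (a + 2 * e + c) + 2 * (x + u) + r + d ≡ (a + c + r + d + 2 * u) + (2 * e + 2 * x)
      regroup = solve-∀
      double : ∀ e x → (2 * e + 2 * x) + (2 * e + 2 * x) ≡ 4 * (x + e)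
      double = solve-∀

  -- the same criterion for the complementary colouring, stated in terms of b
  gain-criterionᶜ : ∀ S' R T' b Δ → let open Colouring S' R T' b in
                    E Q₁ Q₁ + E Q₂ Q₂ + # (lookup R) + Δ + 2 * cross ≤ 2 * E Q₁ Q₂ + 2 * uncut →
                    Gain S' R T' (not ∘ b) Δ
  gain-criterionᶜ S' R T' b Δ H = gain-criterion S' R T' (not ∘ b) Δ (subst₂ _≤_ lhs rhs H)
    where
      open Colouring S' R T' b
      module C = Colouring S' R T' (not ∘ b)
      Q₁≗ : ∀ i → Q₁ i ≡ C.Q₂ i
      Q₁≗ i = sym (part-not-not R b i)
      lhs : E Q₁ Q₁ + E Q₂ Q₂ + # (lookup R) + Δ + 2 * cross ≡
            E C.Q₁ C.Q₁ + E C.Q₂ C.Q₂ + # (lookup R) + Δ + 2 * C.uncut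
      lhs = cong₂ (λ x y → x + # (lookup R) + Δ + 2 * y)
              (trans (+-comm (E Q₁ Q₁) _) (cong (E Q₂ Q₂ +_) (E-cong Q₁≗ Q₁≗)))
              (cong (E P₁ Q₂ +_) (E-cong Q₁≗ (λ _ → refl)))
      rhs : 2 * E Q₁ Q₂ + 2 * uncut ≡ 2 * E C.Q₁ C.Q₂ + 2 * C.cross
      rhs = cong₂ (λ x y → 2 * x + 2 * y)
              (trans (E-sym Q₁ Q₂) (E-congʳ Q₂ Q₁≗))
              (cong₂ _+_ (E-congʳ P₁ Q₁≗) refl)

  -- A colouring of R that, on its own, beats the bound for G[R] by Δ.
  Balanced : Subset N → (Fin N → Bool) → ℕ → Set
  Balanced R b Δ = E (part R b) (part R b) + E (part R (not ∘ b)) (part R (not ∘ b)) + # (lookup R) + Δ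
                   ≤ 2 * E (part R b) (part R (not ∘ b))

  -- A balanced colouring or its complement cuts at least half of the S'–R edges.
  balanced-gain : ∀ S' R b Δ → Balanced R b Δ → ∀ T' → ∃[ c ] Gain S' R T' c Δ
  balanced-gain S' R b Δ H T' = [ keep , flip ]′ (≤-total uncut cross)
    where
      open Colouring S' R T' b
      keep : uncut ≤ cross → ∃[ c ] Gain S' R T' c Δ
      keep u≤c = b , gain-criterion S' R T' b Δ (+-mono-≤ H (*-monoʳ-≤ 2 u≤c))
      flip : cross ≤ uncut → ∃[ c ] Gain S' R T' c Δ
      flip c≤u = not ∘ b , gain-criterionᶜ S' R T' b Δ (+-mono-≤ H (*-monoʳ-≤ 2 c≤u))

  -- A colouring of R that beats the bound for G[R ∪ {v}] by Δ when v is coloured against b.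
  Pendant : Subset N → Fin N → (Fin N → Bool) → ℕ → Set
  Pendant R v b Δ = E (part R b) (part R b) + E (part R (not ∘ b)) (part R (not ∘ b)) + # (lookup R) + Δ
                    + 2 * E (δ v) (part R (not ∘ b))
                    ≤ 2 * E (part R b) (part R (not ∘ b)) + 2 * E (δ v) (part R b)

  private
    pendant-arith : ∀ h e x y u c → h + 2 * y ≤ 2 * e + 2 * x → u + c ≤ x + y → x ≤ c →
                    h + 2 * u ≤ 2 * e + 2 * c
    pendant-arith h e x y u c H u+c≤x+y x≤c = +-cancelʳ-≤ (2 * c) (h + 2 * u) (2 * e + 2 * c) (begin
      h + 2 * u + 2 * c      ≡⟨ regroup₁ h u c ⟩
      h + 2 * (u + c)        ≤⟨ +-monoʳ-≤ h (*-monoʳ-≤ 2 u+c≤x+y) ⟩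
      h + 2 * (x + y)        ≡⟨ regroup₂ h x y ⟩
      (h + 2 * y) + 2 * x    ≤⟨ +-monoˡ-≤ (2 * x) H ⟩
      2 * e + 2 * x + 2 * x  ≤⟨ +-mono-≤ (+-monoʳ-≤ (2 * e) (*-monoʳ-≤ 2 x≤c)) (*-monoʳ-≤ 2 x≤c) ⟩
      2 * e + 2 * c + 2 * c  ∎)
      where
        open ≤-Reasoning
        regroup₁ : ∀ h u c → h + 2 * u + 2 * c ≡ h + 2 * (u + c)
        regroup₁ = solve-∀
        regroup₂ : ∀ h x y → h + 2 * (x + y) ≡ (h + 2 * y) + 2 * x
        regroup₂ = solve-∀

  -- If every S'–R edge meets v ∈ S', then a pendant colouring or its complement gains Δ:
  -- choose the one whose class b lies opposite to v, so the edges from v to it are cut.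
  pendant-gain : ∀ S' R v b Δ → v ∈ S' → E (χ S') (χ R) ≤ E (δ v) (χ R) → Pendant R v b Δ →
                 ∀ T' → ∃[ c ] Gain S' R T' c Δ
  pendant-gain S' R v b Δ v∈S' through-v H T' = by-side-of-v (lookup T' v) refl
    where
      open Colouring S' R T' b
      h : ℕ
      h = E Q₁ Q₁ + E Q₂ Q₂ + # (lookup R) + Δ
      via-v : cross + uncut ≤ E (δ v) Q₁ + E (δ v) Q₂
      via-v = subst₂ _≤_ E-S'R (trans (E-congʳ (δ v) (χ-parts R b)) (E-+ʳ (δ v) Q₁ Q₂)) through-v
      from-v : ∀ P → 1 ≤ P v → E (δ v) Q₁ ≤ E P Q₁
      from-v P 1≤Pv = E-mono {q = Q₁} (δ≤ v P 1≤Pv) (λ _ → ≤-refl)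
      v∈S'-∧ : ∀ {x} → x ≡ true → 1 ≤ ind (lookup S' v ∧ x)
      v∈S'-∧ x≡true = ≤-reflexive (sym (cong₂ (λ s x → ind (s ∧ x)) (∈⇒true v∈S') x≡true))
      by-side-of-v : ∀ x → lookup T' v ≡ x → ∃[ c ] Gain S' R T' c Δ
      by-side-of-v false v∉T' =
        b , gain-criterion S' R T' b Δ
              (pendant-arith h (E Q₁ Q₂) (E (δ v) Q₁) (E (δ v) Q₂) uncut cross H
                             (subst (_≤ E (δ v) Q₁ + E (δ v) Q₂) (+-comm cross uncut) via-v)
                             (≤-trans (from-v P₂ (v∈S'-∧ (cong not v∉T')))
                                      (≤-trans (≤-reflexive (E-sym P₂ Q₁)) (m≤n+m _ _))))
      by-side-of-v true v∈T' =
        not ∘ b , gain-criterionᶜ S' R T' b Δ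
                    (pendant-arith h (E Q₁ Q₂) (E (δ v) Q₁) (E (δ v) Q₂) cross uncut H via-v
                                   (≤-trans (from-v P₁ (v∈S'-∧ v∈T')) (m≤m+n _ _)))

  private
    split-χ : ∀ s r → (r ≡ true → s ≡ true) → ind s ≡ ind (s ∧ not r) + ind r
    split-χ true  true  _ = refl
    split-χ true  false _ = refl
    split-χ false true  h = ⊥-elim (true≢false (h refl) refl)
    split-χ false false _ = refl

    split-in : ∀ s r t c → (r ≡ true → s ≡ true) →
               ind (s ∧ (if r then c else t)) ≡ ind ((s ∧ not r) ∧ t) + ind (r ∧ c)
    split-in true  true  t     c _ = refl
    split-in true  false true  c _ = refl
    split-in true  false false c _ = refl
    split-in false true  t     c h = ⊥-elim (true≢false (h refl) refl)
    split-in false false t     c _ = refl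

    split-out : ∀ s r t c → (r ≡ true → s ≡ true) →
                ind (s ∧ not (if r then c else t)) ≡ ind ((s ∧ not r) ∧ not t) + ind (r ∧ not c)
    split-out true  true  t     c _ = refl
    split-out true  false true  c _ = refl
    split-out true  false false c _ = refl
    split-out false true  t     c h = ⊥-elim (true≢false (h refl) refl)
    split-out false false t     c _ = refl

    combined-⊆ : ∀ s r t c → (r ≡ true → s ≡ true) → (t ≡ true → s ∧ not r ≡ true) →
                 (if r then c else t) ≡ true → s ≡ true
    combined-⊆ s true  t c r⇒s _   c≡true = r⇒s refl
    combined-⊆ s false t c _   t⇒s t≡true = trans (sym (∧-identityʳ s)) (t⇒s t≡true)

    extension-arith : ∀ pp pq qq sp sq Δ c x → qq + 2 * pq + sq + Δ ≤ 4 * x →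
                      (pp + 2 * pq + qq) + (sp + sq) + Δ + 4 * c ≤ 4 * (c + x) + pp + sp
    extension-arith pp pq qq sp sq Δ c x H =
      subst₂ _≤_ (regroup₁ pp pq qq sp sq Δ c) (regroup₂ pp sp c x) (+-monoˡ-≤ (pp + sp + 4 * c) H)
      where
        regroup₁ : ∀ pp pq qq sp sq Δ c →
                   qq + 2 * pq + sq + Δ + (pp + sp + 4 * c) ≡ (pp + 2 * pq + qq) + (sp + sq) + Δ + 4 * c
        regroup₁ = solve-∀
        regroup₂ : ∀ pp sp c x → 4 * x + (pp + sp + 4 * c) ≡ 4 * (c + x) + pp + sp
        regroup₂ = solve-∀

  module Combined (S R : Subset N) (R⊆S : ∀ i → lookup R i ≡ true → lookup S i ≡ true)
                  (T' : Subset N) (b : Fin N → Bool) where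
    S' : Subset N
    S' = S ─ R
    open Colouring S' R T' b

    private
      s r t : Fin N → Bool
      s i = lookup S i
      r i = lookup R i
      t i = lookup T' i
      lookup-S' : ∀ i → lookup S' i ≡ s i ∧ not (r i)
      lookup-S' i = lookup-─ S R i

    T : Subset N
    T = tabulate (λ i → if r i then b i else t i)

    lookup-T : ∀ i → lookup T i ≡ (if r i then b i else t i)
    lookup-T i = lookup∘tabulate (λ i → if r i then b i else t i) i

    T⊆S : T' ⊆ S' → T ⊆ S
    T⊆S T'⊆S' {i} i∈T = true⇒∈ (combined-⊆ (s i) (r i) (t i) (b i) (R⊆S i)
                                   (λ ti → trans (sym (lookup-S' i)) (∈⇒true (T'⊆S' (true⇒∈ ti))))
                                   (trans (sym (lookup-T i)) (∈⇒true i∈T)))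

    χ-S : ∀ i → χ S i ≡ χ S' i + χ R i
    χ-S i = trans (split-χ (s i) (r i) (R⊆S i)) (cong (λ x → ind x + χ R i) (sym (lookup-S' i)))

    edges-split : 2 * edges G S ≡ E (χ S') (χ S') + 2 * E (χ S') (χ R) + E (χ R) (χ R)
    edges-split = trans (edges-as-E S) (trans (E-cong χ-S χ-S) (E-square (χ S') (χ R)))

    size-split : ∣ S ∣ ≡ # (lookup S') + # (lookup R)
    size-split = trans (∣∣≡# S) (trans (∑-cong χ-S) (∑-+ (χ S') (χ R)))

    cut-split : cutSize G S T ≡ cutSize G S' T' + newCut
    cut-split = begin
      cutSize G S T
        ≡⟨ cut-as-E S T ⟩
      E (λ i → ind (s i ∧ lookup T i)) (λ i → ind (s i ∧ not (lookup T i)))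
        ≡⟨ E-cong in-T out-T ⟩
      E (λ i → P₁ i + Q₁ i) (λ i → P₂ i + Q₂ i)
        ≡⟨ trans (E-+ˡ P₁ Q₁ _) (cong₂ _+_ (E-+ʳ P₁ P₂ Q₂) (E-+ʳ Q₁ P₂ Q₂)) ⟩
      (E P₁ P₂ + E P₁ Q₂) + (E Q₁ P₂ + E Q₁ Q₂)
        ≡⟨ regroup (E P₁ P₂) (E P₁ Q₂) (E Q₁ P₂) (E Q₁ Q₂) ⟩
      E P₁ P₂ + newCut
        ≡⟨ cong (_+ newCut) (sym (cut-as-E S' T')) ⟩
      cutSize G S' T' + newCut ∎
      where
        open ≡-Reasoning
        in-T : ∀ i → ind (s i ∧ lookup T i) ≡ P₁ i + Q₁ i
        in-T i = trans (cong (λ x → ind (s i ∧ x)) (lookup-T i))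
                 (trans (split-in (s i) (r i) (t i) (b i) (R⊆S i))
                        (cong (λ x → ind (x ∧ t i) + Q₁ i) (sym (lookup-S' i))))
        out-T : ∀ i → ind (s i ∧ not (lookup T i)) ≡ P₂ i + Q₂ i
        out-T i = trans (cong (λ x → ind (s i ∧ not x)) (lookup-T i))
                  (trans (split-out (s i) (r i) (t i) (b i) (R⊆S i))
                         (cong (λ x → ind (x ∧ not (t i)) + Q₂ i) (sym (lookup-S' i))))
        regroup : ∀ a b c d → (a + b) + (c + d) ≡ a + ((b + c) + d)
        regroup = solve-∀

  extend : ∀ (S R : Subset N) → (∀ i → lookup R i ≡ true → lookup S i ≡ true) → ∀ Δ k →
           (∀ T' → ∃[ b ] Gain (S ─ R) R T' b Δ) →
           YesInstance G (S ─ R) (k ℤ.- ℤ.+ Δ) → YesInstance G S k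
  extend S R R⊆S Δ k gains (T' , T'⊆S' , bound) with gains T'
  ... | b , gain = T , T⊆S T'⊆S' , bound-transfer (2 * edges G S) (∣ S ∣) (4 * cutSize G S T)
                                                  (2 * edges G S') (∣ S' ∣) (4 * cutSize G S' T') Δ k
                                                  larger-gains bound
    where
      open Combined S R R⊆S T' b
      open Colouring S' R T' b using (newCut)
      larger-gains : 2 * edges G S + ∣ S ∣ + Δ + 4 * cutSize G S' T' ≤
                     4 * cutSize G S T + 2 * edges G S' + ∣ S' ∣
      larger-gains =
        subst₂ _≤_ (sym (cong₂ (λ m n → m + n + Δ + 4 * cutSize G S' T') edges-split size-split))
                   (sym (cong₃ (λ c m n → 4 * c + m + n) cut-split (edges-as-E S') (∣∣≡# S')))
                   (extension-arith (E (χ S') (χ S')) (E (χ S') (χ R)) (E (χ R) (χ R))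
                                    (# (lookup S')) (# (lookup R)) Δ (cutSize G S' T') newCut gain)

module Connectivity {N : ℕ} (G : Graph N) where
  open EdgeForm G

  adj-sym : ∀ {u w} → Adj G u w → Adj G w u
  adj-sym {u} {w} e = trans (Graph.sym G w u) e

  reach-end : ∀ {S u w} → Reach G S u w → w ∈ S
  reach-end (here w∈S)     = w∈S
  reach-end (step _ _ w∈S) = w∈S

  reach-trans : ∀ {S u w v} → Reach G S u w → Reach G S w v → Reach G S u v
  reach-trans p (here _)       = p
  reach-trans p (step q e v∈S) = step (reach-trans p q) e v∈S

  reach-sym : ∀ {S u v} → Reach G S u v → Reach G S v u
  reach-sym (here u∈S)     = here u∈S
  reach-sym (step p e v∈S) = reach-trans (step (here v∈S) (adj-sym e) (reach-end p)) (reach-sym p)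

  reach-mono : ∀ {A B u v} → (∀ {i} → i ∈ A → i ∈ B) → Reach G A u v → Reach G B u v
  reach-mono A⊆B (here u∈A)     = here (A⊆B u∈A)
  reach-mono A⊆B (step p e v∈A) = step (reach-mono A⊆B p) e (A⊆B v∈A)

  connected-⇔ : ∀ {A B} → (∀ {i} → i ∈ A → i ∈ B) → (∀ {i} → i ∈ B → i ∈ A) → Connected G B → Connected G A
  connected-⇔ A⊆B B⊆A ((x , x∈B) , paths) =
    (x , B⊆A x∈B) , λ u v u∈A v∈A → reach-mono B⊆A (paths u v (A⊆B u∈A) (A⊆B v∈A))

  module Component-of (S X : Subset N) (v : Fin N) (cX : Component G (S ─ ⁅ v ⁆) X) where

    X⊆S : ∀ {i} → lookup X i ≡ true → lookup S i ≡ true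
    X⊆S i∈X = proj₁ (∈─⁻ (proj₁ cX (true⇒∈ i∈X)))

    X∌v : lookup X v ≡ false
    X∌v with lookup X v in v∈?X
    ... | false = refl
    ... | true  = ⊥-elim (true≢false (∈⁅⁆ v) (proj₂ (∈─⁻ (proj₁ cX (true⇒∈ v∈?X)))))

    isolated : ∀ {u w} → lookup X u ≡ true → lookup S w ≡ true → lookup X w ≡ false → w ≢ v →
               adj G u w ≡ false
    isolated {u} {w} u∈X w∈S w∉X w≢v with adj G u w in uw
    ... | false = refl
    ... | true  = ⊥-elim (proj₂ (proj₂ cX) u w (true⇒∈ u∈X) (∈─⁺ w∈S (∉⁅⁆ w≢v))
                                 (λ w∈X → true≢false (∈⇒true w∈X) w∉X) uw)

    avoid : ∀ {w} → v ∈ S ─ X → Reach G S v w → lookup X w ≡ false → Reach G (S ─ X) v w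
    avoid v∈S-X (here _) _ = here v∈S-X
    avoid {w} v∈S-X (step {w'} p e w∈S) w∉X with lookup X w' in w'∈?X | w ≟ᶠ v
    ... | false | _         = step (avoid v∈S-X p w'∈?X) e (∈─⁺ (∈⇒true w∈S) w∉X)
    ... | true  | yes refl  = here v∈S-X
    ... | true  | no w≢v    = ⊥-elim (true≢false e (isolated w'∈?X (∈⇒true w∈S) w∉X w≢v))

    -- Removing X from a connected S leaves it connected (through v).
    remove-connected : Connected G S → v ∈ S → Connected G (S ─ X)
    remove-connected (_ , paths) v∈S = (v , v∈S-X) , λ u w u∈ w∈ →
      let (u∈S , u∉X) = ∈─⁻ u∈
          (w∈S , w∉X) = ∈─⁻ w∈ in
      reach-trans (reach-sym (avoid v∈S-X (paths v u v∈S (true⇒∈ u∈S)) u∉X))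
                  (avoid v∈S-X (paths v w v∈S (true⇒∈ w∈S)) w∉X)
      where
        v∈S-X : v ∈ S ─ X
        v∈S-X = ∈─⁺ (∈⇒true v∈S) X∌v

    -- v has a neighbour in X: a path in S from X to v leaves X through one.
    neighbour-in : Connected G S → v ∈ S → ∃ λ a → lookup X a ≡ true × adj G v a ≡ true
    neighbour-in (_ , paths) v∈S with exit (paths x v (true⇒∈ (X⊆S x∈X)) v∈S)
      where
        x : Fin N
        x = proj₁ (proj₁ (proj₁ (proj₂ cX)))
        x∈X : lookup X x ≡ true
        x∈X = ∈⇒true (proj₂ (proj₁ (proj₁ (proj₂ cX))))
        exit : ∀ {w} → Reach G S x w → lookup X w ≡ true ⊎ ∃ λ a → lookup X a ≡ true × adj G v a ≡ true
        exit (here _) = inj₁ x∈X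
        exit {w} (step {w'} p e w∈S) with exit p
        ... | inj₂ found = inj₂ found
        ... | inj₁ w'∈X with lookup X w in w∈?X | w ≟ᶠ v
        ...   | true  | _        = inj₁ refl
        ...   | false | yes refl = inj₂ (w' , w'∈X , adj-sym e)
        ...   | false | no w≢v   = ⊥-elim (true≢false e (isolated w'∈X (∈⇒true w∈S) w∈?X w≢v))
    ... | inj₁ v∈X  = ⊥-elim (true≢false v∈X X∌v)
    ... | inj₂ found = found

    through-v : E (χ (S ─ X)) (χ X) ≤ E (δ v) (χ X)
    through-v = ∑-mono (λ i → ∑-mono (λ j → pointwise i j))
      where
        pointwise : ∀ i j → χ (S ─ X) i * χ X j * A i j ≤ δ v i * χ X j * A i j
        pointwise i j with i =ᵇ v in i=v
        ... | true  = *-monoˡ-≤ (A i j) (*-monoˡ-≤ (χ X j) (ind≤1 (lookup (S ─ X) i)))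
        ... | false with lookup (S ─ X) i in i∈S-X | lookup X j in j∈X | adj G i j in ij
        ...   | false | _     | _     = z≤n
        ...   | true  | false | _     = z≤n
        ...   | true  | true  | false = z≤n
        ...   | true  | true  | true  =
          let (i∈S , i∉X) = ∈─⁻ {A = S} {X} (true⇒∈ i∈S-X) in
          ⊥-elim (true≢false (trans (Graph.sym G j i) ij) (isolated j∈X i∈S i∉X (=ᵇ-false⇒≢ i=v)))

module Cliques {N : ℕ} (G : Graph N) where
  open Connectivity G

  clique-⊆ : ∀ {X Y} → Clique G X → Y ⊆ X → Clique G Y
  clique-⊆ cl Y⊆X u w u∈Y w∈Y = cl u w (Y⊆X u∈Y) (Y⊆X w∈Y)

  clique-∪-⁅⁆ : ∀ {X v} → Clique G X → (∀ j → j ∈ X → Adj G v j) → Clique G (X ∪ ⁅ v ⁆)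
  clique-∪-⁅⁆ {X} {v} cl v-adj u w u∈ w∈ u≢w with x∈p∪q⁻ X ⁅ v ⁆ u∈ | x∈p∪q⁻ X ⁅ v ⁆ w∈
  ... | inj₁ u∈X | inj₁ w∈X = cl u w u∈X w∈X u≢w
  ... | inj₁ u∈X | inj₂ w∈v = subst (Adj G u) (sym (x∈⁅y⁆⇒x≡y v w∈v)) (adj-sym (v-adj u u∈X))
  ... | inj₂ u∈v | inj₁ w∈X = subst (λ x → Adj G x w) (sym (x∈⁅y⁆⇒x≡y v u∈v)) (v-adj w w∈X)
  ... | inj₂ u∈v | inj₂ w∈v = ⊥-elim (u≢w (trans (x∈⁅y⁆⇒x≡y v u∈v) (sym (x∈⁅y⁆⇒x≡y v w∈v))))

  clique-connected : ∀ {X} → Clique G X → Nonempty X → Connected G X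
  clique-connected {X} cl nonempty = nonempty , path
    where
      path : ∀ u w → u ∈ X → w ∈ X → Reach G X u w
      path u w u∈X w∈X with u ≟ᶠ w
      ... | yes refl = here u∈X
      ... | no u≢w   = step (here u∈X) (cl u w u∈X w∈X u≢w) w∈X

module Clique-split {N : ℕ} (G : Graph N) (X : Subset N) (cl : Clique G X) (q : Fin N → Bool) where
  open EdgeForm G
  open Extension G

  B C : Fin N → ℕ
  B = part X q
  C = part X (not ∘ q)

  #X : # (lookup X) ≡ ∑ B + ∑ C
  #X = trans (∑-cong (χ-parts X q)) (∑-+ B C)

  E-BB : E B B + ∑ B ≡ ∑ B * ∑ B
  E-BB = trans (cong (E B B +_) (∑-cong (λ i → cong ind (sym (∧-idem (lookup X i ∧ q i))))))
               (E-clique X cl _ _ (λ i → ∧-conicalˡ _ _) (λ i → ∧-conicalˡ _ _))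

  E-CC : E C C + ∑ C ≡ ∑ C * ∑ C
  E-CC = trans (cong (E C C +_) (∑-cong (λ i → cong ind (sym (∧-idem (lookup X i ∧ not (q i)))))))
               (E-clique X cl _ _ (λ i → ∧-conicalˡ _ _) (λ i → ∧-conicalˡ _ _))

  E-BC : E B C ≡ ∑ B * ∑ C
  E-BC = trans (sym (trans (cong (E B C +_) (trans (∑-cong (λ i → cong ind (disjoint (lookup X i) (q i)))) (∑-zero {N})))
                           (+-identityʳ _)))
               (E-clique X cl _ _ (λ i → ∧-conicalˡ _ _) (λ i → ∧-conicalˡ _ _))
    where
      disjoint : ∀ x c → (x ∧ c) ∧ (x ∧ not c) ≡ false
      disjoint true  true  = refl
      disjoint true  false = refl
      disjoint false _     = refl

  ∑B-⊆ : (∀ i → q i ≡ true → lookup X i ≡ true) → ∑ B ≡ # q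
  ∑B-⊆ q⊆X = ∑-cong (λ i → cong ind (∧-absorbs (lookup X i) (q i) (q⊆X i)))

  module Sizes (b c : ℕ) (∑B≡b : ∑ B ≡ b) (#X≡b+c : # (lookup X) ≡ b + c) where
    ∑C : ∑ C ≡ c
    ∑C = +-cancelˡ-≡ b (∑ C) c (trans (cong (_+ ∑ C) (sym ∑B≡b)) (trans (sym #X) #X≡b+c))

    BB : E B B + b ≡ b * b
    BB = subst (λ z → E B B + z ≡ z * z) ∑B≡b E-BB

    CC : E C C + c ≡ c * c
    CC = subst (λ z → E C C + z ≡ z * z) ∑C E-CC

    BC : E B C ≡ b * c
    BC = trans E-BC (cong₂ _*_ ∑B≡b ∑C)

halves : ∀ t → t ≡ (t / 2 + t % 2) + t / 2
halves t = trans (m≡m%n+[m/n]*n t 2) (regroup (t % 2) (t / 2))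
  where
    regroup : ∀ ε c → ε + c * 2 ≡ (c + ε) + c
    regroup = solve-∀

%2≤1 : ∀ t → t % 2 ≤ 1
%2≤1 t = ≤-pred (m%n<n t 2)

≤1-cases : ∀ {ε} → ε ≤ 1 → ε ≡ 0 ⊎ ε ≡ 1
≤1-cases z≤n       = inj₁ refl
≤1-cases (s≤s z≤n) = inj₂ refl

-- Rule 1 with class sizes c + ε and c, where bb = (c + ε)(c + ε - 1) and cc = c(c - 1) count
-- the edges inside the classes: the pendant inequality holds, even with equality.
rule1-arith : ∀ bb cc c ε → ε ≤ 1 → bb + (c + ε) ≡ (c + ε) * (c + ε) → cc + c ≡ c * c →
              bb + cc + ((c + ε) + c) + ε + 2 * c ≤ 2 * ((c + ε) * c) + 2 * (c + ε)
rule1-arith bb cc c ε ε≤1 BB CC = ≤-reflexive (begin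
  bb + cc + ((c + ε) + c) + ε + 2 * c         ≡⟨ regroup bb cc c ε ⟩
  (bb + (c + ε)) + (cc + c) + ε + 2 * c       ≡⟨ cong₂ (λ x y → x + y + ε + 2 * c) BB CC ⟩
  (c + ε) * (c + ε) + c * c + ε + 2 * c       ≡⟨ square (≤1-cases ε≤1) ⟩
  2 * ((c + ε) * c) + 2 * (c + ε)             ∎)
  where
    open ≡-Reasoning
    regroup : ∀ bb cc c ε → bb + cc + ((c + ε) + c) + ε + 2 * c ≡ (bb + (c + ε)) + (cc + c) + ε + 2 * c
    regroup = solve-∀
    -- (c + ε)² + c² + ε = 2(c + ε)c + 2ε exactly when ε² = ε
    square : ε ≡ 0 ⊎ ε ≡ 1 → (c + ε) * (c + ε) + c * c + ε + 2 * c ≡ 2 * ((c + ε) * c) + 2 * (c + ε)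
    square (inj₁ refl) = even c
      where
        even : ∀ c → (c + 0) * (c + 0) + c * c + 0 + 2 * c ≡ 2 * ((c + 0) * c) + 2 * (c + 0)
        even = solve-∀
    square (inj₂ refl) = odd c
      where
        odd : ∀ c → (c + 1) * (c + 1) + c * c + 1 + 2 * c ≡ 2 * ((c + 1) * c) + 2 * (c + 1)
        odd = solve-∀

-- Rule 1: X ∪ {v} is a clique and X a component of G[S] - v.  Colouring the larger
-- half of X like v's opposite side shows that removing X costs ∣X∣ mod 2.
module Rule1 {N : ℕ} (G : Graph N) (S X : Subset N) (v : Fin N)
             (cX : Component G (S ─ ⁅ v ⁆) X) (cl : Clique G (X ∪ ⁅ v ⁆)) where
  open EdgeForm G
  open Extension G
  open Connectivity G
  open Component-of S X v cX
  open Cliques G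

  clique-X : Clique G X
  clique-X = clique-⊆ cl (λ i∈X → x∈p∪q⁺ (inj₁ i∈X))

  v-adj : ∀ j → lookup X j ≡ true → adj G v j ≡ true
  v-adj j j∈X = cl v j (x∈p∪q⁺ (inj₂ (x∈⁅x⁆ v))) (x∈p∪q⁺ (inj₁ (true⇒∈ j∈X)))
                   (λ { refl → true≢false j∈X X∌v })

  t c ε : ℕ
  t = ∣ X ∣
  c = t / 2
  ε = t % 2

  #X≡t : # (lookup X) ≡ (c + ε) + c
  #X≡t = trans (sym (∣∣≡# X)) (halves t)

  -- colour a larger half of X (c + ε vertices) against v
  pendant : ∃[ q ] Pendant X v q ε
  pendant with choose (lookup X) (c + ε) (subst (c + ε ≤_) (sym #X≡t) (m≤m+n (c + ε) c))
  ... | q , q⊆X , #q = q , subst₂ _≤_ lhs rhs (rule1-arith (E B B) (E C C) c ε (%2≤1 t) BB CC)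
    where
      open Clique-split G X clique-X q
      open Sizes (c + ε) c (trans (∑B-⊆ q⊆X) #q) #X≡t
      v-all : ∀ (p : Fin N → Bool) → E (δ v) (λ j → ind (lookup X j ∧ p j)) ≡ # (λ j → lookup X j ∧ p j)
      v-all p = E-δ-complete v (λ j → lookup X j ∧ p j) (λ j h → v-adj j (∧-conicalˡ _ _ h))
      lhs : E B B + E C C + ((c + ε) + c) + ε + 2 * c ≡
            E B B + E C C + # (lookup X) + ε + 2 * E (δ v) C
      lhs = cong₂ (λ n d → E B B + E C C + n + ε + 2 * d) (sym #X≡t) (sym (trans (v-all (not ∘ q)) ∑C))
      rhs : 2 * ((c + ε) * c) + 2 * (c + ε) ≡ 2 * E B C + 2 * E (δ v) B
      rhs = cong₂ (λ x y → 2 * x + 2 * y) (sym BC) (sym (trans (v-all q) (trans (∑B-⊆ q⊆X) #q)))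

  reflects-yes : v ∈ S → ∀ k → YesInstance G (S ─ X) (k ℤ.- ℤ.+ ε) → YesInstance G S k
  reflects-yes v∈S k = extend S X (λ i → X⊆S) ε k
    (pendant-gain (S ─ X) X v (proj₁ pendant) ε (∈─⁺ (∈⇒true v∈S) X∌v) through-v (proj₂ pendant))

-- Splitting X (|X| = b + c, b = c + ε) so that v's d neighbours favour the larger half:
-- b₁ of them go there, together with b₀ non-neighbours, and the remaining dC neighbours
-- in the smaller half are paid for.
Rule2Counts : ℕ → ℕ → ℕ → Set
Rule2Counts c ε d = ∃[ b₁ ] ∃[ b₀ ] (b₁ ≤ d × b₀ + d ≤ (c + ε) + c × b₁ + b₀ ≡ c + ε ×
  (∀ dC → b₁ + dC ≡ d → (c + ε) * (c + ε) + c * c + 2 + 2 * dC ≤ 2 * ((c + ε) * c) + 2 * b₁))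

rule2-arith : ∀ c ε d → ε ≤ 1 → 2 ≤ d → suc d ≤ (c + ε) + c → Rule2Counts c ε d
rule2-arith c ε d ε≤1 2≤d d<t = [ all-neighbours , half-neighbours ]′ (≤-total d b)
  where
    b : ℕ
    b = c + ε
    εε≤ε : ε * ε ≤ ε
    εε≤ε = subst (ε * ε ≤_) (*-identityˡ ε) (*-monoˡ-≤ ε ε≤1)
    -- (c + ε)² + c² = 2(c + ε)c + ε²: only the imbalance ε² remains to be paid for
    imbalance : ∀ dC b₁ → ε * ε + 2 + 2 * dC ≤ 2 * b₁ → b * b + c * c + 2 + 2 * dC ≤ 2 * (b * c) + 2 * b₁
    imbalance dC b₁ h = subst (_≤ 2 * (b * c) + 2 * b₁) (expand c ε dC) (+-monoʳ-≤ (2 * (b * c)) h)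
      where
        expand : ∀ c ε dC → 2 * ((c + ε) * c) + (ε * ε + 2 + 2 * dC) ≡ (c + ε) * (c + ε) + c * c + 2 + 2 * dC
        expand = solve-∀
    -- d ≤ b: all neighbours go to the larger half
    all-neighbours : d ≤ b → Rule2Counts c ε d
    all-neighbours d≤b with m≤n⇒∃[o]m+o≡n d≤b
    ... | e , d+e≡b = d , e , ≤-refl , e+d≤t , d+e≡b , λ dC d+dC≡d → imbalance dC d (pay dC d+dC≡d)
      where
        e+d≤t : e + d ≤ b + c
        e+d≤t = subst (_≤ b + c) (trans (sym d+e≡b) (+-comm d e)) (m≤m+n b c)
        pay : ∀ dC → d + dC ≡ d → ε * ε + 2 + 2 * dC ≤ 2 * d
        pay dC d+dC≡d rewrite +-cancelˡ-≡ d dC 0 (trans d+dC≡d (sym (+-identityʳ d))) = begin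
          ε * ε + 2 + 0  ≤⟨ +-monoˡ-≤ 0 (+-monoˡ-≤ 2 (≤-trans εε≤ε ε≤1)) ⟩
          3              ≤⟨ n≤1+n 3 ⟩
          2 * 2          ≤⟨ *-monoʳ-≤ 2 2≤d ⟩
          2 * d          ∎
          where open ≤-Reasoning
    -- b ≤ d: the larger half consists of neighbours only
    half-neighbours : b ≤ d → Rule2Counts c ε d
    half-neighbours b≤d = b , 0 , b≤d , ≤-trans (n≤1+n d) d<t , +-identityʳ b ,
                          λ dC b+dC≡d → imbalance dC b (pay dC b+dC≡d)
      where
        pay : ∀ dC → b + dC ≡ d → ε * ε + 2 + 2 * dC ≤ 2 * b
        pay dC b+dC≡d = begin
          ε * ε + 2 + 2 * dC    ≡⟨ regroup (ε * ε) dC ⟩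
          ε * ε + 2 * suc dC    ≤⟨ +-mono-≤ εε≤ε (*-monoʳ-≤ 2 dC<c) ⟩
          ε + 2 * c             ≤⟨ m≤n+m (ε + 2 * c) ε ⟩
          ε + (ε + 2 * c)       ≡⟨ double c ε ⟩
          2 * b                 ∎
          where
            open ≤-Reasoning
            dC<c : suc dC ≤ c
            dC<c = +-cancelˡ-≤ b (suc dC) c (subst (_≤ b + c) (trans (cong suc (sym b+dC≡d)) (sym (+-suc b dC))) d<t)
            regroup : ∀ x dC → x + 2 + 2 * dC ≡ x + 2 * suc dC
            regroup = solve-∀
            double : ∀ c ε → ε + (ε + 2 * c) ≡ 2 * (c + ε)
            double = solve-∀

-- Rule 2: Rule 1 does not apply and the clique X is a component of G[S] - v.  Then v has at
-- least two neighbours and a non-neighbour in X, and a pendant colouring of X pays 2.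
module Rule2 {N : ℕ} (G : Graph N) (S X : Subset N) (v : Fin N) (cS : Connected G S) (v∈S : v ∈ S)
             (cX : Component G (S ─ ⁅ v ⁆) X) (clX : Clique G X) (no-rule1 : ¬ Rule1Applicable G S) where
  open EdgeForm G
  open Extension G
  open Connectivity G
  open Component-of S X v cX
  open Cliques G

  -- otherwise Rule 1 would apply to (v, X)
  non-neighbour : ∃[ z ] (lookup X z ≡ true × adj G v z ≡ false)
  non-neighbour with find (λ i → lookup X i ∧ not (adj G v i))
  ... | inj₁ (z , h) = z , ∧-conicalˡ _ _ h , not-true (∧-conicalʳ (lookup X z) _ h)
  ... | inj₂ none    = ⊥-elim (no-rule1 (v , X , v∈S , cX , clique-∪-⁅⁆ clX v-adj))
    where
      v-adj : ∀ j → j ∈ X → Adj G v j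
      v-adj j j∈X with adj G v j in vj
      ... | true  = refl
      ... | false = ⊥-elim (true≢false (∧-intro (∈⇒true j∈X) (not-false vj)) (none j))

  a₁ : Fin N
  a₁ = proj₁ (neighbour-in cS v∈S)

  a₁∈X : lookup X a₁ ≡ true
  a₁∈X = proj₁ (proj₂ (neighbour-in cS v∈S))

  v-a₁ : adj G v a₁ ≡ true
  v-a₁ = proj₂ (proj₂ (neighbour-in cS v∈S))

  -- If a₁ were v's only neighbour in X, Rule 1 would apply to (a₁, X - a₁): the clique
  -- X - a₁ is nonempty (it contains a non-neighbour of v) and only touches S through a₁.
  sole-neighbour⇒rule1 : (∀ u → lookup X u ≡ true → adj G v u ≡ true → u ≡ a₁) → Rule1Applicable G S
  sole-neighbour⇒rule1 only =
    a₁ , Y , true⇒∈ (X⊆S a₁∈X) , (Y⊆ , clique-connected clY (z , z∈Y) , Y-isolated) , clique-⊆ clX Y∪a₁⊆X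
    where
      Y : Subset N
      Y = X ─ ⁅ a₁ ⁆
      Y⊆ : Y ⊆ S ─ ⁅ a₁ ⁆
      Y⊆ i∈Y = let (i∈X , i≠a₁) = ∈─⁻ {A = X} i∈Y in ∈─⁺ (X⊆S i∈X) i≠a₁
      Y∪a₁⊆X : Y ∪ ⁅ a₁ ⁆ ⊆ X
      Y∪a₁⊆X {i} i∈ with x∈p∪q⁻ Y ⁅ a₁ ⁆ i∈
      ... | inj₁ i∈Y  = p─q⊆p X ⁅ a₁ ⁆ i∈Y
      ... | inj₂ i∈a₁ = true⇒∈ (subst (λ x → lookup X x ≡ true) (sym (x∈⁅y⁆⇒x≡y a₁ i∈a₁)) a₁∈X)
      clY : Clique G Y
      clY = clique-⊆ clX (p─q⊆p X ⁅ a₁ ⁆)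
      z : Fin N
      z = proj₁ non-neighbour
      z∈Y : z ∈ Y
      z∈Y = ∈─⁺ (proj₁ (proj₂ non-neighbour))
                (∉⁅⁆ (λ z≡a₁ → true≢false (subst (λ x → adj G v x ≡ true) (sym z≡a₁) v-a₁)
                                          (proj₂ (proj₂ non-neighbour))))
      Y-isolated : ∀ u w → u ∈ Y → w ∈ S ─ ⁅ a₁ ⁆ → w ∉ Y → ¬ Adj G u w
      Y-isolated u w u∈Y w∈ w∉Y uw with ∈─⁻ {A = X} u∈Y | ∈─⁻ {A = S} w∈ | lookup X w in w∈?X | w ≟ᶠ v
      ... | _ , _      | _ , w≠a₁ | true  | _        = w∉Y (∈─⁺ w∈?X w≠a₁)
      ... | u∈X , u≠a₁ | _        | false | yes refl = ⁅⁆-false⇒≢ u≠a₁ (only u u∈X (adj-sym uw))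
      ... | u∈X , _    | w∈S , _  | false | no w≢v   = true≢false uw (isolated u∈X w∈S w∈?X w≢v)

  second-neighbour : ∃[ a₂ ] (lookup X a₂ ≡ true × adj G v a₂ ≡ true × a₂ ≢ a₁)
  second-neighbour with find (λ u → lookup X u ∧ adj G v u ∧ not (u =ᵇ a₁))
  ... | inj₁ (a , h) = a , ∧-conicalˡ _ _ h , ∧-conicalˡ _ _ rest ,
                       =ᵇ-false⇒≢ (not-true (∧-conicalʳ (adj G v a) _ rest))
    where
      rest : adj G v a ∧ not (a =ᵇ a₁) ≡ true
      rest = ∧-conicalʳ (lookup X a) _ h
  ... | inj₂ none = ⊥-elim (no-rule1 (sole-neighbour⇒rule1 only))
    where
      only : ∀ u → lookup X u ≡ true → adj G v u ≡ true → u ≡ a₁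
      only u u∈X vu with u =ᵇ a₁ in u=a₁
      ... | true  = =ᵇ⇒≡ u=a₁
      ... | false = ⊥-elim (true≢false (∧-intro u∈X (∧-intro vu (not-false u=a₁))) (none u))

  t c ε d n₀ : ℕ
  t = ∣ X ∣
  c = t / 2
  ε = t % 2
  d = # (λ j → lookup X j ∧ adj G v j)
  n₀ = # (λ j → lookup X j ∧ not (adj G v j))

  d+n₀≡t : d + n₀ ≡ t
  d+n₀≡t = sym (trans (∣∣≡# X) (trans (∑-cong (χ-parts X (adj G v))) (∑-+ (part X (adj G v)) (part X (not ∘ adj G v)))))

  2≤d : 2 ≤ d
  2≤d = let (a₂ , a₂∈X , v-a₂ , a₂≢a₁) = second-neighbour in
        #-≥2 _ a₁ a₂ (λ a₁≡a₂ → a₂≢a₁ (sym a₁≡a₂)) (∧-intro a₁∈X v-a₁) (∧-intro a₂∈X v-a₂)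

  d<t : suc d ≤ t
  d<t = let (z , z∈X , v-z) = non-neighbour in
        subst (suc d ≤_) d+n₀≡t (subst (_≤ d + n₀) (+-comm d 1)
          (+-monoʳ-≤ d (#-≥1 _ z (∧-intro z∈X (not-false v-z)))))

  private
    -- a colouring made of q₁ (neighbours) and q₀ (non-neighbours of v) inside X
    size-in : ∀ x n a o → (a ≡ true → x ∧ n ≡ true) → (o ≡ true → x ∧ not n ≡ true) →
              ind (x ∧ (a ∨ o)) ≡ ind a + ind o
    size-in true  true  true  true  _  h₀ = ⊥-elim (true≢false (h₀ refl) refl)
    size-in true  false true  _     h₁ _  = ⊥-elim (true≢false (h₁ refl) refl)
    size-in false _     true  _     h₁ _  = ⊥-elim (true≢false (h₁ refl) refl)
    size-in false _     false true  _  h₀ = ⊥-elim (true≢false (h₀ refl) refl)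
    size-in true  true  true  false _  _  = refl
    size-in true  _     false true  _  _  = refl
    size-in true  _     false false _  _  = refl
    size-in false _     false false _  _  = refl

    neighbours-in : ∀ x n a o → (a ≡ true → x ∧ n ≡ true) → (o ≡ true → x ∧ not n ≡ true) →
                    (x ∧ (a ∨ o)) ∧ n ≡ a
    neighbours-in true  true  true  true  _  h₀ = ⊥-elim (true≢false (h₀ refl) refl)
    neighbours-in true  false true  _     h₁ _  = ⊥-elim (true≢false (h₁ refl) refl)
    neighbours-in false _     true  _     h₁ _  = ⊥-elim (true≢false (h₁ refl) refl)
    neighbours-in false _     false true  _  h₀ = ⊥-elim (true≢false (h₀ refl) refl)
    neighbours-in true  true  true  false _  _  = refl
    neighbours-in true  true  false true  _  h₀ = ⊥-elim (true≢false (h₀ refl) refl)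
    neighbours-in true  false false true  _  _  = refl
    neighbours-in true  _     false false _  _  = refl
    neighbours-in false _     false false _  _  = refl

  #X≡t : # (lookup X) ≡ (c + ε) + c
  #X≡t = trans (sym (∣∣≡# X)) (halves t)

  -- colour b₁ neighbours and b₀ non-neighbours of v in X against v (Rule2Counts)
  pendant : ∃[ q ] Pendant X v q 2
  pendant with rule2-arith c ε d (%2≤1 t) 2≤d (subst (suc d ≤_) (halves t) d<t)
  ... | b₁ , b₀ , b₁≤d , b₀+d≤t , b₁+b₀≡b , pays
    with choose (λ j → lookup X j ∧ adj G v j) b₁ b₁≤d | choose (λ j → lookup X j ∧ not (adj G v j)) b₀ b₀≤n₀
    where
      b₀≤n₀ : b₀ ≤ n₀
      b₀≤n₀ = +-cancelʳ-≤ d b₀ n₀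
                (subst (b₀ + d ≤_) (trans (sym (halves t)) (trans (sym d+n₀≡t) (+-comm d n₀))) b₀+d≤t)
  ... | q₁ , q₁⊆ , #q₁ | q₀ , q₀⊆ , #q₀ = q , subst₂ _≤_ lhs rhs (pays dC b₁+dC≡d)
    where
      q : Fin N → Bool
      q j = q₁ j ∨ q₀ j
      open Clique-split G X clX q
      b : ℕ
      b = c + ε
      ∑B : ∑ B ≡ b
      ∑B = trans (∑-cong (λ j → size-in (lookup X j) (adj G v j) (q₁ j) (q₀ j) (q₁⊆ j) (q₀⊆ j)))
                 (trans (∑-+ (λ j → ind (q₁ j)) (λ j → ind (q₀ j))) (trans (cong₂ _+_ #q₁ #q₀) b₁+b₀≡b))
      open Sizes b c ∑B #X≡t
      vB : E (δ v) B ≡ b₁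
      vB = trans (E-δ-# v (λ j → lookup X j ∧ q j))
                 (trans (∑-cong (λ j → cong ind (neighbours-in (lookup X j) (adj G v j) (q₁ j) (q₀ j) (q₁⊆ j) (q₀⊆ j))))
                        #q₁)
      dC : ℕ
      dC = E (δ v) C
      b₁+dC≡d : b₁ + dC ≡ d
      b₁+dC≡d = begin
        b₁ + dC                    ≡⟨ cong (_+ dC) (sym vB) ⟩
        E (δ v) B + dC             ≡⟨ sym (E-+ʳ (δ v) B C) ⟩
        E (δ v) (λ j → B j + C j)  ≡⟨ sym (E-congʳ (δ v) (χ-parts X q)) ⟩
        E (δ v) (χ X)              ≡⟨ E-δ-# v (lookup X) ⟩
        d                          ∎
        where open ≡-Reasoning
      lhs : b * b + c * c + 2 + 2 * dC ≡ E B B + E C C + # (lookup X) + 2 + 2 * dC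
      lhs = begin
        b * b + c * c + 2 + 2 * dC                  ≡⟨ cong₂ (λ x y → x + y + 2 + 2 * dC) (sym BB) (sym CC) ⟩
        (E B B + b) + (E C C + c) + 2 + 2 * dC      ≡⟨ regroup (E B B) b (E C C) c dC ⟩
        E B B + E C C + (b + c) + 2 + 2 * dC        ≡⟨ cong (λ x → E B B + E C C + x + 2 + 2 * dC) (sym #X≡t) ⟩
        E B B + E C C + # (lookup X) + 2 + 2 * dC   ∎
        where
          open ≡-Reasoning
          regroup : ∀ a x e y z → (a + x) + (e + y) + 2 + 2 * z ≡ a + e + (x + y) + 2 + 2 * z
          regroup = solve-∀
      rhs : 2 * (b * c) + 2 * b₁ ≡ 2 * E B C + 2 * E (δ v) B
      rhs = cong₂ (λ x y → 2 * x + 2 * y) (sym BC) (sym vB)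

  reflects-yes : ∀ k → YesInstance G (S ─ X) (k ℤ.- ℤ.+ 2) → YesInstance G S k
  reflects-yes k = extend S X (λ i → X⊆S) 2 k
            (pendant-gain (S ─ X) X v (proj₁ pendant) 2 (∈─⁺ (∈⇒true v∈S) X∌v) through-v (proj₂ pendant))

-- Rule 3: a path a – b – c with a, c non-adjacent whose removal keeps G[S] connected.
-- Colouring b against a and c cuts both edges of the path, which pays 1.
module Rule3 {N : ℕ} (G : Graph N) (S : Subset N) (a b c : Fin N) (a∈S : a ∈ S) (b∈S : b ∈ S) (c∈S : c ∈ S)
             (a≢c : a ≢ c) (ab : Adj G a b) (bc : Adj G b c) (¬ac : ¬ Adj G a c) where
  open EdgeForm G
  open Extension G
  open Connectivity G

  R : Subset N
  R = ⁅ a ⁆ ∪ ⁅ b ⁆ ∪ ⁅ c ⁆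

  lookup-R : ∀ i → lookup R i ≡ (i =ᵇ a) ∨ ((i =ᵇ b) ∨ (i =ᵇ c))
  lookup-R i = trans (lookup-pair∪ a b ⁅ c ⁆ i) (cong (λ z → (i =ᵇ a) ∨ ((i =ᵇ b) ∨ z)) (lookup-⁅⁆ c i))

  R⊆S : ∀ i → lookup R i ≡ true → lookup S i ≡ true
  R⊆S = pair∪-⊆ a∈S b∈S (λ i i∈c → subst (λ x → lookup S x ≡ true)
                                           (sym (=ᵇ⇒≡ (trans (sym (lookup-⁅⁆ c i)) i∈c))) (∈⇒true c∈S))

  a≢b : a ≢ b
  a≢b refl = true≢false ab (irrefl G a)

  b≢c : b ≢ c
  b≢c refl = true≢false bc (irrefl G b)

  private
    middle : ∀ x y z → (x ∨ (y ∨ z)) ∧ y ≡ y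
    middle x     false z = ∧-zeroʳ (x ∨ z)
    middle true  true  z = refl
    middle false true  z = refl

    ends : ∀ x y z → x ∧ y ≡ false → y ∧ z ≡ false → x ∧ z ≡ false → ind ((x ∨ (y ∨ z)) ∧ not y) ≡ ind x + ind z
    ends true  true  _     ()  _  _
    ends true  false true  _   _  ()
    ends true  false false _   _  _  = refl
    ends false true  true  _   () _
    ends false true  false _   _  _  = refl
    ends false false true  _   _  _  = refl
    ends false false false _   _  _  = refl

  colour : Fin N → Bool
  colour i = i =ᵇ b

  Q₁≗ : ∀ i → part R colour i ≡ δ b i
  Q₁≗ i = cong ind (trans (cong (_∧ (i =ᵇ b)) (lookup-R i)) (middle (i =ᵇ a) (i =ᵇ b) (i =ᵇ c)))

  Q₂≗ : ∀ i → part R (not ∘ colour) i ≡ δ a i + δ c i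
  Q₂≗ i = trans (cong (λ x → ind (x ∧ not (i =ᵇ b))) (lookup-R i))
                (ends (i =ᵇ a) (i =ᵇ b) (i =ᵇ c) (=ᵇ-disjoint i a≢b) (=ᵇ-disjoint i b≢c) (=ᵇ-disjoint i a≢c))

  -- inside R the colouring cuts both path edges and nothing else: 0 + 0 + 3 + 1 ≤ 2 · 2
  balanced : Balanced R colour 1
  balanced = subst₂ _≤_ (sym (cong₃ (λ x y z → x + y + z + 1) Q₁Q₁ Q₂Q₂ #R)) (sym (cong (2 *_) Q₁Q₂)) ≤-refl
    where
      Q₁Q₁ : E (part R colour) (part R colour) ≡ 0
      Q₁Q₁ = trans (E-cong Q₁≗ Q₁≗) (trans (E-δδ b b) (A-diag b))
      Q₂Q₂ : E (part R (not ∘ colour)) (part R (not ∘ colour)) ≡ 0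
      Q₂Q₂ = trans (E-cong Q₂≗ Q₂≗) (E-independent-pair a c (¬-not ¬ac))
      Q₁Q₂ : E (part R colour) (part R (not ∘ colour)) ≡ 2
      Q₁Q₂ = trans (E-cong Q₁≗ Q₂≗) (trans (E-+ʳ (δ b) (δ a) (δ c))
               (cong₂ _+_ (trans (E-δδ b a) (cong ind (adj-sym ab))) (trans (E-δδ b c) (cong ind bc))))
      #R : # (lookup R) ≡ 3
      #R = trans (∑-cong (χ-parts R colour))
             (trans (∑-+ (part R colour) (part R (not ∘ colour)))
               (cong₂ _+_ (trans (∑-cong Q₁≗) (∑-δ≡1 b))
                          (trans (∑-cong Q₂≗) (trans (∑-+ (δ a) (δ c)) (cong₂ _+_ (∑-δ≡1 a) (∑-δ≡1 c))))))

  reflects-yes : ∀ k → YesInstance G (S ─ R) (k ℤ.- ℤ.+ 1) → YesInstance G S k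
  reflects-yes k = extend S R R⊆S 1 k (balanced-gain (S ─ R) R colour 1 balanced)

rule4-sizes : ∀ t → 1 ≤ t → ∃[ a ] ∃[ c ] ∃[ Δ ] (t ≡ a + c × a ≡ c + Δ × (Δ ≡ 1 ⊎ Δ ≡ 2))
rule4-sizes t 1≤t = split (t / 2) (t % 2) (%2≤1 t) (subst (1 ≤_) (halves t) 1≤t) (halves t)
  where
    split : ∀ c ε → ε ≤ 1 → 1 ≤ (c + ε) + c → t ≡ (c + ε) + c →
            ∃[ a ] ∃[ c ] ∃[ Δ ] (t ≡ a + c × a ≡ c + Δ × (Δ ≡ 1 ⊎ Δ ≡ 2))
    split c       1 _ _ t≡ = suc c , c , 1 , trans t≡ (cong (_+ c) (+-comm c 1)) , +-comm 1 c , inj₁ refl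
    split (suc c) 0 _ _ t≡ = suc (suc c) , c , 2 , trans t≡ (regroup c) , +-comm 2 c , inj₂ refl
      where
        regroup : ∀ c → (suc c + 0) + suc c ≡ suc (suc c) + c
        regroup = solve-∀
    split zero    0 _ () _
    split _ (suc (suc _)) (s≤s ()) _ _

-- With a = c + Δ, Δ ∈ {1, 2}: the imbalance Δ² + 3 is at most 4Δ.
rule4-arith : ∀ bb cc a c Δ → bb + a ≡ a * a → cc + c ≡ c * c → a ≡ c + Δ → (Δ ≡ 1 ⊎ Δ ≡ 2) →
              bb + (0 + 2 * (c + c) + cc) + (a + (1 + 1 + c)) + 1 ≤ 2 * ((a + a) + a * c)
rule4-arith bb cc a c Δ BB CC refl Δ∈ = begin
  bb + (0 + 2 * (c + c) + cc) + ((c + Δ) + (1 + 1 + c)) + 1  ≡⟨ regroup bb cc (c + Δ) c ⟩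
  (bb + (c + Δ)) + (cc + c) + 4 * c + 3                      ≡⟨ cong₂ (λ x y → x + y + 4 * c + 3) BB CC ⟩
  (c + Δ) * (c + Δ) + c * c + 4 * c + 3                      ≤⟨ small Δ∈ ⟩
  2 * (((c + Δ) + (c + Δ)) + (c + Δ) * c)                    ∎
  where
    open ≤-Reasoning
    regroup : ∀ bb cc a c → bb + (0 + 2 * (c + c) + cc) + (a + (1 + 1 + c)) + 1 ≡ (bb + a) + (cc + c) + 4 * c + 3
    regroup = solve-∀
    small : (Δ ≡ 1 ⊎ Δ ≡ 2) → (c + Δ) * (c + Δ) + c * c + 4 * c + 3 ≤ 2 * (((c + Δ) + (c + Δ)) + (c + Δ) * c)
    small (inj₁ refl) = ≤-reflexive (one c)
      where
        one : ∀ c → (c + 1) * (c + 1) + c * c + 4 * c + 3 ≡ 2 * (((c + 1) + (c + 1)) + (c + 1) * c)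
        one = solve-∀
    small (inj₂ refl) = subst ((c + 2) * (c + 2) + c * c + 4 * c + 3 ≤_) (two c) (m≤m+n _ 1)
      where
        two : ∀ c → (c + 2) * (c + 2) + c * c + 4 * c + 3 + 1 ≡ 2 * (((c + 2) + (c + 2)) + (c + 2) * c)
        two = solve-∀

-- Rule 4: x, y are non-adjacent, G[S] - {x, y} consists of the components X and Y, and x and y
-- are both adjacent to all of the clique X.  Colouring x, y against a larger half of X pays 1.
module Rule4 {N : ℕ} (G : Graph N) (S : Subset N) (x y : Fin N) (X Y : Subset N) (x∈S : x ∈ S) (y∈S : y ∈ S)
             (x≢y : x ≢ y) (¬xy : ¬ Adj G x y)
             (cX : Component G (S ─ (⁅ x ⁆ ∪ ⁅ y ⁆)) X) (cY : Component G (S ─ (⁅ x ⁆ ∪ ⁅ y ⁆)) Y)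
             (X∩Y : Empty (X ∩ Y)) (X∪Y : (X ∪ Y) ≡ (S ─ (⁅ x ⁆ ∪ ⁅ y ⁆)))
             (clx : Clique G (X ∪ ⁅ x ⁆)) (cly : Clique G (X ∪ ⁅ y ⁆)) where
  open EdgeForm G
  open Extension G
  open Connectivity G
  open Cliques G

  R : Subset N
  R = ⁅ x ⁆ ∪ ⁅ y ⁆ ∪ X

  lookup-R : ∀ i → lookup R i ≡ (i =ᵇ x) ∨ ((i =ᵇ y) ∨ lookup X i)
  lookup-R = lookup-pair∪ x y X

  outside-x,y : ∀ {i} → lookup (⁅ x ⁆ ∪ ⁅ y ⁆) i ≡ false → (i =ᵇ x) ≡ false × (i =ᵇ y) ≡ false
  outside-x,y {i} i∉ = trans (sym (lookup-⁅⁆ x i)) (∨-conicalˡ _ _ i∉′) ,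
                       trans (sym (lookup-⁅⁆ y i)) (∨-conicalʳ (lookup ⁅ x ⁆ i) _ i∉′)
    where
      i∉′ : lookup ⁅ x ⁆ i ∨ lookup ⁅ y ⁆ i ≡ false
      i∉′ = trans (sym (lookup-∪ ⁅ x ⁆ ⁅ y ⁆ i)) i∉

  inside-x,y : ∀ {i} → (i =ᵇ x) ≡ false → (i =ᵇ y) ≡ false → lookup (⁅ x ⁆ ∪ ⁅ y ⁆) i ≡ false
  inside-x,y {i} i≠x i≠y =
    trans (lookup-∪ ⁅ x ⁆ ⁅ y ⁆ i) (cong₂ _∨_ (trans (lookup-⁅⁆ x i) i≠x) (trans (lookup-⁅⁆ y i) i≠y))

  X⊆S : ∀ {i} → lookup X i ≡ true → lookup S i ≡ true
  X⊆S i∈X = proj₁ (∈─⁻ (proj₁ cX (true⇒∈ i∈X)))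

  X∌x,y : ∀ {i} → lookup X i ≡ true → (i =ᵇ x) ≡ false × (i =ᵇ y) ≡ false
  X∌x,y i∈X = outside-x,y (proj₂ (∈─⁻ (proj₁ cX (true⇒∈ i∈X))))

  sees-X : ∀ z → Clique G (X ∪ ⁅ z ⁆) → (∀ {j} → lookup X j ≡ true → (j =ᵇ z) ≡ false) →
           ∀ j → lookup X j ≡ true → adj G z j ≡ true
  sees-X z cl X∌z j j∈X = cl z j (x∈p∪q⁺ (inj₂ (x∈⁅x⁆ z))) (x∈p∪q⁺ (inj₁ (true⇒∈ j∈X)))
                             (λ { refl → true≢false (=ᵇ-refl z) (X∌z j∈X) })

  x-adj : ∀ j → lookup X j ≡ true → adj G x j ≡ true
  x-adj = sees-X x clx (proj₁ ∘ X∌x,y)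

  y-adj : ∀ j → lookup X j ≡ true → adj G y j ≡ true
  y-adj = sees-X y cly (proj₂ ∘ X∌x,y)

  R⊆S : ∀ i → lookup R i ≡ true → lookup S i ≡ true
  R⊆S = pair∪-⊆ x∈S y∈S (λ i → X⊆S)

  S─R⊆Y : ∀ {i} → i ∈ S ─ R → i ∈ Y
  S─R⊆Y {i} i∈ =
    [ (λ i∈X → ⊥-elim (i∉X i∈X)) , (λ i∈Y → i∈Y) ]′ (x∈p∪q⁻ X Y (subst (i ∈_) (sym X∪Y) i∈S─xy))
    where
      i∉R : (i =ᵇ x) ∨ ((i =ᵇ y) ∨ lookup X i) ≡ false
      i∉R = trans (sym (lookup-R i)) (proj₂ (∈─⁻ {A = S} {B = R} i∈))
      i∉X : i ∉ X
      i∉X i∈X = true≢false (∈⇒true i∈X) (∨-conicalʳ (i =ᵇ y) _ (∨-conicalʳ (i =ᵇ x) _ i∉R))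
      i∈S─xy : i ∈ S ─ (⁅ x ⁆ ∪ ⁅ y ⁆)
      i∈S─xy = ∈─⁺ (proj₁ (∈─⁻ {A = S} {B = R} i∈))
                   (inside-x,y (∨-conicalˡ _ _ i∉R) (∨-conicalˡ _ _ (∨-conicalʳ (i =ᵇ x) _ i∉R)))

  Y⊆S─R : ∀ {i} → i ∈ Y → i ∈ S ─ R
  Y⊆S─R {i} i∈Y = ∈─⁺ i∈S (trans (lookup-R i) (cong₂ _∨_ i≠x (cong₂ _∨_ i≠y i∉X)))
    where
      i∈S─xy : i ∈ S ─ (⁅ x ⁆ ∪ ⁅ y ⁆)
      i∈S─xy = subst (i ∈_) X∪Y (x∈p∪q⁺ (inj₂ i∈Y))
      i∈S : lookup S i ≡ true
      i∈S = proj₁ (∈─⁻ i∈S─xy)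
      i≠x : (i =ᵇ x) ≡ false
      i≠x = proj₁ (outside-x,y (proj₂ (∈─⁻ i∈S─xy)))
      i≠y : (i =ᵇ y) ≡ false
      i≠y = proj₂ (outside-x,y (proj₂ (∈─⁻ i∈S─xy)))
      i∉X : lookup X i ≡ false
      i∉X = ¬-not (λ i∈X → X∩Y (i , x∈p∩q⁺ (true⇒∈ i∈X , i∈Y)))

  connected : Connected G (S ─ R)
  connected = connected-⇔ S─R⊆Y Y⊆S─R (proj₁ (proj₂ cY))

  private
    -- the complement of a colouring q ⊆ X inside R consists of x, y and X ∖ q
    outside : ∀ ex ey xi qi → ex ∧ ey ≡ false → ex ∧ xi ≡ false → ey ∧ xi ≡ false → (qi ≡ true → xi ≡ true) →
              ind ((ex ∨ (ey ∨ xi)) ∧ not qi) ≡ ind ex + ind ey + ind (xi ∧ not qi)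
    outside true  true  _     _     () _  _  _
    outside true  false true  _     _  () _  _
    outside true  false false true  _  _  _  h = ⊥-elim (true≢false (h refl) refl)
    outside true  false false false _  _  _  _ = refl
    outside false true  true  _     _  _  () _
    outside false true  false true  _  _  _  h = ⊥-elim (true≢false (h refl) refl)
    outside false true  false false _  _  _  _ = refl
    outside false false _     _     _  _  _  _ = refl

  -- X is nonempty, being connected
  t : ℕ
  t = # (lookup X)

  1≤t : 1 ≤ t
  1≤t = let (i , i∈X) = proj₁ (proj₁ (proj₂ cX)) in #-≥1 (lookup X) i (∈⇒true i∈X)

  clique-X : Clique G X
  clique-X = clique-⊆ clx (λ i∈X → x∈p∪q⁺ (inj₁ i∈X))

  -- Colour the a vertices of q ⊆ X true, and x, y and the other c vertices of X false.
  module Split (q : Fin N → Bool) (q⊆X : ∀ i → q i ≡ true → lookup X i ≡ true)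
               (a c : ℕ) (#q≡a : # q ≡ a) (t≡a+c : t ≡ a + c) where
    open Clique-split G X clique-X q public
    open Sizes a c (trans (∑B-⊆ q⊆X) #q≡a) t≡a+c public

    Q₁ Q₂ D : Fin N → ℕ
    Q₁ = part R q
    Q₂ = part R (not ∘ q)
    D i = δ x i + δ y i

    Q₁≗ : ∀ i → Q₁ i ≡ B i
    Q₁≗ i = cong ind (trans (∧-absorbs (lookup R i) (q i) q⊆R) (sym (∧-absorbs (lookup X i) (q i) (q⊆X i))))
      where
        q⊆R : q i ≡ true → lookup R i ≡ true
        q⊆R qi = trans (lookup-R i) (∨-introʳ {i =ᵇ x} (∨-introʳ {i =ᵇ y} (q⊆X i qi)))

    Q₂≗ : ∀ i → Q₂ i ≡ D i + C i
    Q₂≗ i = trans (cong (λ r → ind (r ∧ not (q i))) (lookup-R i))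
                  (outside (i =ᵇ x) (i =ᵇ y) (lookup X i) (q i) (=ᵇ-disjoint i x≢y)
                           (excluded (i =ᵇ x) (lookup X i) (proj₁ ∘ X∌x,y))
                           (excluded (i =ᵇ y) (lookup X i) (proj₂ ∘ X∌x,y)) (q⊆X i))
      where
        excluded : ∀ e b → (b ≡ true → e ≡ false) → e ∧ b ≡ false
        excluded e true  h = trans (∧-identityʳ e) (h refl)
        excluded e false _ = ∧-zeroʳ e

    D-sees : ∀ (p : Fin N → Bool) → (∀ j → p j ≡ true → lookup X j ≡ true) →
             E D (λ j → ind (p j)) ≡ # p + # p
    D-sees p p⊆X = trans (E-+ˡ (δ x) (δ y) _)
                         (cong₂ _+_ (E-δ-complete x p (λ j h → x-adj j (p⊆X j h)))
                                    (E-δ-complete y p (λ j h → y-adj j (p⊆X j h))))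

    Q₂Q₂ : E Q₂ Q₂ ≡ 0 + 2 * (c + c) + E C C
    Q₂Q₂ = trans (E-cong Q₂≗ Q₂≗) (trans (E-square D C)
             (cong₂ (λ z w → z + 2 * w + E C C) (E-independent-pair x y (¬-not ¬xy))
                    (trans (D-sees _ (λ j → ∧-conicalˡ _ _)) (cong₂ _+_ ∑C ∑C))))

    Q₁Q₂ : E Q₁ Q₂ ≡ (a + a) + a * c
    Q₁Q₂ = trans (E-cong Q₁≗ Q₂≗) (trans (E-+ʳ B D C)
             (cong₂ _+_ (trans (E-sym B D) (trans (D-sees _ (λ j → ∧-conicalˡ _ _)) (cong₂ _+_ ∑B ∑B))) BC))
      where
        ∑B : ∑ B ≡ a
        ∑B = trans (∑B-⊆ q⊆X) #q≡a

    #R : # (lookup R) ≡ a + (1 + 1 + c)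
    #R = trans (∑-cong (χ-parts R q)) (trans (∑-+ Q₁ Q₂) (cong₂ _+_ (trans (∑-cong Q₁≗) (trans (∑B-⊆ q⊆X) #q≡a))
           (trans (∑-cong Q₂≗) (trans (∑-+ D C) (cong₂ _+_ #D ∑C)))))
      where
        #D : ∑ D ≡ 1 + 1
        #D = trans (∑-+ (δ x) (δ y)) (cong₂ _+_ (∑-δ≡1 x) (∑-δ≡1 y))

  -- colour a larger part of X (a = c + Δ vertices) against x and y
  balanced : ∃[ q ] Balanced R q 1
  balanced with rule4-sizes t 1≤t
  ... | a , c , Δ , t≡a+c , a≡c+Δ , Δ∈ with choose (lookup X) a (subst (a ≤_) (sym t≡a+c) (m≤m+n a c))
  ... | q , q⊆X , #q = q , subst₂ _≤_ (sym lhs) (sym (cong (2 *_) Q₁Q₂)) (rule4-arith (E B B) (E C C) a c Δ BB CC a≡c+Δ Δ∈)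
    where
      open Split q q⊆X a c #q t≡a+c
      lhs : E Q₁ Q₁ + E Q₂ Q₂ + # (lookup R) + 1 ≡ E B B + (0 + 2 * (c + c) + E C C) + (a + (1 + 1 + c)) + 1
      lhs = cong₃ (λ u w z → u + w + z + 1) (E-cong Q₁≗ Q₁≗) Q₂Q₂ #R

  reflects-yes : ∀ k → YesInstance G (S ─ R) (k ℤ.- ℤ.+ 1) → YesInstance G S k
  reflects-yes k = extend S R R⊆S 1 k (balanced-gain (S ─ R) R (proj₁ balanced) 1 (proj₂ balanced))

lemma5 : (N : ℕ) (G : Graph N) (S : Subset N) (k : ℤ) (S' : Subset N) (k' : ℤ) →
    Connected G S → RuleStep G S k S' k' →
    Connected G S' × (YesInstance G S' k' → YesInstance G S k)
lemma5 N G S k _ _ connected-S (rule1 v X (v∈S , cX , clique)) =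
  Connectivity.Component-of.remove-connected G S X v cX connected-S v∈S ,
  Rule1.reflects-yes G S X v cX clique v∈S k
lemma5 N G S k _ _ connected-S (rule2 v X no-rule1 v∈S cX clique) =
  Connectivity.Component-of.remove-connected G S X v cX connected-S v∈S ,
  Rule2.reflects-yes G S X v connected-S v∈S cX clique no-rule1 k
lemma5 N G S k _ _ _ (rule3 a b c a∈S b∈S c∈S a≢c ab bc ¬ac connected-rest) =
  connected-rest ,
  Rule3.reflects-yes G S a b c a∈S b∈S c∈S a≢c ab bc ¬ac k
lemma5 N G S k _ _ _ (rule4 x y X Y x∈S y∈S x≢y ¬xy cX cY X∩Y X∪Y clx cly) =
  Rule4.connected G S x y X Y x∈S y∈S x≢y ¬xy cX cY X∩Y X∪Y clx cly ,
  Rule4.reflects-yes G S x y X Y x∈S y∈S x≢y ¬xy cX cY X∩Y X∪Y clx cly k
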